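{- Let $n\ge 4$ and let $S(a,b)$ be a double star tree on $n$ vertices, where $a,b\ge 1$ are integers with $a+b=n-2$. Then $$n^2+3n+\frac{4}{n}-16\leq BH(S(a,b))\leq n^2-2n+4\left\lceil\frac{n-2}{2}\right\rceil\left\lfloor\frac{n-2}{2}\right\rfloor+\frac{\left(\lceil\frac{n-2}{2}\rceil\lfloor\frac{n-2}{2}\rfloor+1\right)^2}{n},$$ where the left equality holds if and only if $S(a,b)\cong S(1,n-3)$, and the right equality holds if and only if $S(a,b)\cong S(\lceil\frac{n-2}{2}\rceil, \lfloor\frac{n-2}{2}\rfloor)$.
   Context: The double star $S(a,b)$ is the tree obtained from $K_2$ by attaching $a$ pendant edges to one endpoint and $b$ pendant edges to the other. For a graph $G$ on $n$ vertices with Laplacian $L(G)=D(G)-A(G)$ and Laplacian eigenvalues $0=\lambda_1\le\lambda_2\le\cdots\le\lambda_n$, the biharmonic index is $BH(G)=\frac12\sum_{u,v}d_B^2(u,v)$ ($d_B^2$ the squared biharmonic distance), equivalently $BH(G)=n\sum_{i=2}^n\lambda_i^{ -2}$. -}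

module Defs where

open import Data.Bool using (Bool; true; false; not; if_then_else_)
open import Data.Nat as ℕ using (ℕ; zero; suc; _<ᵇ_)
open import Data.Integer using (+_)
open import Data.Fin using (Fin; zero; suc; toℕ; _≟_)
open import Data.Rational using (ℚ; _+_; _*_; _-_; -_; 0ℚ; 1ℚ; ½; _/_)
open import Relation.Nullary using (does)
open import Relation.Binary.PropositionalEquality using (_≡_)
open import Function.Bundles using (_↔_; Inverse)

Graph : ℕ → Set
Graph n = Fin n → Fin n → Bool

Σ : ∀ {n} → (Fin n → ℚ) → ℚ
Σ {zero}  f = 0ℚ
Σ {suc n} f = f zero + Σ (λ i → f (suc i))

ℕ→ℚ : ℕ → ℚ
ℕ→ℚ k = (+ k) / 1

Matrix : ℕ → Set
Matrix n = Fin n → Fin n → ℚ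

_⊗_ : ∀ {n} → Matrix n → Matrix n → Matrix n
(A ⊗ B) i j = Σ (λ k → A i k * B k j)

transpose : ∀ {n} → Matrix n → Matrix n
transpose A i j = A j i

degree : ∀ {n} → Graph n → Fin n → ℚ
degree G i = Σ (λ j → if G i j then 1ℚ else 0ℚ)

laplacian : ∀ {n} → Graph n → Matrix n
laplacian G i j =
  (if does (i ≟ j) then degree G i else 0ℚ) - (if G i j then 1ℚ else 0ℚ)

-- M is the Moore–Penrose pseudoinverse of L (Penrose equations; unique if it exists).
IsPseudoInverse : ∀ {n} → Matrix n → Matrix n → Set
IsPseudoInverse L M =
  (L ⊗ (M ⊗ L) ≡ L) × (M ⊗ (L ⊗ M) ≡ M) ×
  (transpose (L ⊗ M) ≡ L ⊗ M) × (transpose (M ⊗ L) ≡ M ⊗ L)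
  where open import Data.Product using (_×_)

-- Squared biharmonic distance d_B^2(u,v) = ‖L⁺(e_u − e_v)‖², with M = L⁺.
biharmonicDist² : ∀ {n} → Matrix n → Fin n → Fin n → ℚ
biharmonicDist² M u v = Σ (λ k → (M k u - M k v) * (M k u - M k v))

BH : ∀ {n} → Matrix n → ℚ
BH M = ½ * Σ (λ u → Σ (λ v → biharmonicDist² M u v))

-- Double star S(a,b) on Fin (2 + a + b): vertex 0 and vertex 1 are the adjacent
-- centres; leaf 2+k (k : Fin (a+b)) is attached to vertex 0 if k < a, else to vertex 1.
doubleStar : (a b : ℕ) → Graph (2 ℕ.+ a ℕ.+ b)
doubleStar a b = adj
  where
  toU : Fin (a ℕ.+ b) → Bool
  toU k = toℕ k <ᵇ a
  adj : Graph (suc (suc (a ℕ.+ b)))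
  adj zero          zero          = false
  adj zero          (suc zero)    = true
  adj (suc zero)    zero          = true
  adj (suc zero)    (suc zero)    = false
  adj zero          (suc (suc k)) = toU k
  adj (suc zero)    (suc (suc k)) = not (toU k)
  adj (suc (suc k)) zero          = toU k
  adj (suc (suc k)) (suc zero)    = not (toU k)
  adj (suc (suc k)) (suc (suc l)) = false

_≅_ : ∀ {m n} → Graph m → Graph n → Set
_≅_ {m} {n} G H =
  Σ' (Fin m ↔ Fin n) (λ σ → ∀ i j → H (Inverse.to σ i) (Inverse.to σ j) ≡ G i j)
  where open import Data.Product renaming (Σ to Σ')

-- The Laplacian L of a tree and its distance matrix D satisfy L D = τ 1ᵀ − 2 I with τ = 2 − deg:
-- from a vertex i, exactly one neighbour is closer to any other vertex j. With the centring
-- matrix P = I − J/n this makes X = −½ P D P a solution of the Penrose equations for L, and the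
-- Moore–Penrose inverse is unique, so BH can be read off X. For S(a,b) every quantity involved
-- is constant on the four parts of the vertex set (two centres, a leaves, b leaves), and one finds
-- BH = n² + 4ab − 2n + (ab + 1)²/n, strictly increasing in ab. With a + b = n − 2 fixed, ab lies
-- between n − 3, attained only when a = 1 or b = 1, and ⌈(n−2)/2⌉⌊(n−2)/2⌋, attained only by the
-- balanced split. Conversely, Σ deg² = (a + b)² − 2ab + 3(a + b) + 2 is an isomorphism invariant,
-- so isomorphic double stars on n vertices have the same product ab.

module Submission where

open import Defs

open import Data.Nat as ℕ using (ℕ; zero; suc; NonZero; _∸_; ⌈_/2⌉; ⌊_/2⌋; _<ᵇ_; s≤s)
  renaming (_+_ to _+ℕ_; _*_ to _*ℕ_; _≤_ to _≤ℕ_)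
import Data.Nat.Properties as ℕP
open import Data.Nat.Tactic.RingSolver using () renaming (solve-∀ to ℕ-solve-∀)
open import Data.Integer as ℤ using (+_)
import Data.Integer.Properties as ℤP
open import Data.Integer.GCD using (gcd; gcd-zeroʳ)
open import Data.Rational using (ℚ; _+_; _*_; _-_; -_; 0ℚ; 1ℚ; ½; _/_; _≤_; _<_; toℚᵘ; ↥_; ↧_)
import Data.Rational.Properties as ℚP
import Data.Rational.Unnormalised as ℚᵘ
import Data.Rational.Unnormalised.Properties as ℚᵘP
open import Data.Rational.Solver using (module +-*-Solver)
open import Tactic.RingSolver using (solve-∀)
import Tactic.RingSolver.Core.AlmostCommutativeRing as ACR
open import Algebra.Bundles using (CommutativeRing)
import Algebra.Properties.Semiring.Sum as SemiringSum
open import Algebra.Properties.Ring ℚP.+-*-ring using (x[y-z]≈xy-xz; [y-z]x≈yx-zx)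
open import Data.Bool using (Bool; true; false; not; if_then_else_)
open import Data.Bool.Properties using (not-involutive)
open import Data.Fin using (Fin; zero; suc; _≟_; toℕ; splitAt; join)
open import Data.Fin.Properties using (splitAt-join; join-splitAt; splitAt⁻¹-↑ˡ; splitAt⁻¹-↑ʳ; toℕ-↑ˡ; toℕ-↑ʳ; toℕ<n)
open import Data.Vec using (Vec; _∷_; [])
open import Data.Product as Product using (_×_; _,_; proj₁; proj₂)
open import Data.Sum as Sum using (_⊎_; inj₁; inj₂)
open import Data.Sum.Properties using (swap-involutive)
open import Data.Empty using (⊥)
open import Function.Bundles using (_↔_; Inverse; mk↔ₛ′; _⇔_; mk⇔; Equivalence)
open import Function.Construct.Identity using (↔-id)
open import Level using (0ℓ)
open import Relation.Nullary using (does; yes; no; contradiction)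
open import Relation.Nullary.Decidable using (dec⇒maybe)
open import Relation.Binary.Bundles using (Setoid)
open import Relation.Binary.Definitions using (tri<; tri≈; tri>)
import Relation.Binary.Reasoning.Setoid as SetoidReasoning
open import Relation.Binary.PropositionalEquality

ℚ-ring : ACR.AlmostCommutativeRing 0ℓ 0ℓ
ℚ-ring = ACR.fromCommutativeRing ℚP.+-*-commutativeRing (λ x → dec⇒maybe (0ℚ ℚP.≟ x))

2ℚ 3ℚ 4ℚ : ℚ
2ℚ = 1ℚ + 1ℚ
3ℚ = 2ℚ + 1ℚ
4ℚ = 2ℚ + 2ℚ

toℚᵘ-/ : ∀ x n .{{_ : NonZero n}} → toℚᵘ ((+ x) / n) ℚᵘ.≃ ℚᵘ.mkℚᵘ (+ x) (ℕ.pred n)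
toℚᵘ-/ x n@(suc n-1) = ℚᵘ.*≡* (begin
  ℚᵘ.↥ (toℚᵘ p) ℤ.* + n  ≡⟨ cong (ℤ._* + n) (ℚP.↥ᵘ-toℚᵘ p) ⟩
  ↥ p ℤ.* + n            ≡⟨ cong (↥ p ℤ.*_) (ℚP.↧-/ (+ x) n) ⟨
  ↥ p ℤ.* (↧ p ℤ.* g)    ≡⟨ cong (↥ p ℤ.*_) (ℤP.*-comm (↧ p) g) ⟩
  ↥ p ℤ.* (g ℤ.* ↧ p)    ≡⟨ ℤP.*-assoc (↥ p) g (↧ p) ⟨
  ↥ p ℤ.* g ℤ.* ↧ p      ≡⟨ cong (ℤ._* ↧ p) (ℚP.↥-/ (+ x) n) ⟩
  + x ℤ.* ↧ p            ≡⟨ cong (+ x ℤ.*_) (ℚP.↧ᵘ-toℚᵘ p) ⟨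
  + x ℤ.* ℚᵘ.↧ (toℚᵘ p)  ∎)
  where
  open ≡-Reasoning
  p = (+ x) / n
  g = gcd (+ x) (+ n)

ℕ→ℚ-≃ : ∀ x → toℚᵘ (ℕ→ℚ x) ℚᵘ.≃ ℚᵘ.mkℚᵘ (+ x) 0
ℕ→ℚ-≃ x = toℚᵘ-/ x 1

ℕ→ℚ-+ : ∀ x y → ℕ→ℚ (x +ℕ y) ≡ ℕ→ℚ x + ℕ→ℚ y
ℕ→ℚ-+ x y = ℚP.toℚᵘ-injective (begin
  toℚᵘ (ℕ→ℚ (x +ℕ y))                  ≈⟨ ℕ→ℚ-≃ (x +ℕ y) ⟩
  ℚᵘ.mkℚᵘ (+ (x +ℕ y)) 0                ≈⟨ ℚᵘ.*≡* eq ⟩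
  ℚᵘ.mkℚᵘ (+ x) 0 ℚᵘ.+ ℚᵘ.mkℚᵘ (+ y) 0   ≈⟨ ℚᵘP.+-cong (ℕ→ℚ-≃ x) (ℕ→ℚ-≃ y) ⟨
  toℚᵘ (ℕ→ℚ x) ℚᵘ.+ toℚᵘ (ℕ→ℚ y)        ≈⟨ ℚP.toℚᵘ-homo-+ (ℕ→ℚ x) (ℕ→ℚ y) ⟨
  toℚᵘ (ℕ→ℚ x + ℕ→ℚ y)                  ∎)
  where
  open ℚᵘP.≃-Reasoning
  eq : + (x +ℕ y) ℤ.* + 1 ≡ (+ x ℤ.* + 1 ℤ.+ + y ℤ.* + 1) ℤ.* + 1
  eq = cong (ℤ._* + 1) (trans (ℤP.pos-+ x y)
    (sym (cong₂ ℤ._+_ (ℤP.*-identityʳ (+ x)) (ℤP.*-identityʳ (+ y)))))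

ℕ→ℚ-* : ∀ x y → ℕ→ℚ (x *ℕ y) ≡ ℕ→ℚ x * ℕ→ℚ y
ℕ→ℚ-* x y = ℚP.toℚᵘ-injective (begin
  toℚᵘ (ℕ→ℚ (x *ℕ y))                  ≈⟨ ℕ→ℚ-≃ (x *ℕ y) ⟩
  ℚᵘ.mkℚᵘ (+ (x *ℕ y)) 0                ≈⟨ ℚᵘ.*≡* (cong (ℤ._* + 1) (ℤP.pos-* x y)) ⟩
  ℚᵘ.mkℚᵘ (+ x) 0 ℚᵘ.* ℚᵘ.mkℚᵘ (+ y) 0   ≈⟨ ℚᵘP.*-cong (ℕ→ℚ-≃ x) (ℕ→ℚ-≃ y) ⟨
  toℚᵘ (ℕ→ℚ x) ℚᵘ.* toℚᵘ (ℕ→ℚ y)        ≈⟨ ℚP.toℚᵘ-homo-* (ℕ→ℚ x) (ℕ→ℚ y) ⟨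
  toℚᵘ (ℕ→ℚ x * ℕ→ℚ y)                  ∎)
  where open ℚᵘP.≃-Reasoning

/-as-* : ∀ x n .{{_ : NonZero n}} → (+ x) / n ≡ ℕ→ℚ x * ((+ 1) / n)
/-as-* x n@(suc n-1) = ℚP.toℚᵘ-injective (begin
  toℚᵘ ((+ x) / n)                          ≈⟨ toℚᵘ-/ x n ⟩
  ℚᵘ.mkℚᵘ (+ x) n-1                         ≈⟨ ℚᵘ.*≡* eq ⟩
  ℚᵘ.mkℚᵘ (+ x) 0 ℚᵘ.* ℚᵘ.mkℚᵘ (+ 1) n-1     ≈⟨ ℚᵘP.*-cong (ℕ→ℚ-≃ x) (toℚᵘ-/ 1 n) ⟨
  toℚᵘ (ℕ→ℚ x) ℚᵘ.* toℚᵘ ((+ 1) / n)        ≈⟨ ℚP.toℚᵘ-homo-* (ℕ→ℚ x) _ ⟨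
  toℚᵘ (ℕ→ℚ x * ((+ 1) / n))                ∎)
  where
  open ℚᵘP.≃-Reasoning
  eq : + x ℤ.* + suc (n-1 +ℕ 0) ≡ (+ x ℤ.* + 1) ℤ.* + n
  eq rewrite ℕP.+-identityʳ n-1 | ℤP.*-identityʳ (+ x) = refl

*-1/n : ∀ n .{{_ : NonZero n}} → ℕ→ℚ n * ((+ 1) / n) ≡ 1ℚ
*-1/n n@(suc _) = trans (sym (/-as-* n n)) (ℚP.toℚᵘ-injective (begin
  toℚᵘ ((+ n) / n)         ≈⟨ toℚᵘ-/ n n ⟩
  ℚᵘ.mkℚᵘ (+ n) (ℕ.pred n)  ≈⟨ ℚᵘ.*≡* (ℤP.*-comm (+ n) (+ 1)) ⟩
  toℚᵘ 1ℚ                  ∎))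
  where open ℚᵘP.≃-Reasoning

ℕ→ℚ-injective : ∀ {x y} → ℕ→ℚ x ≡ ℕ→ℚ y → x ≡ y
ℕ→ℚ-injective {x} {y} eq = ℤP.+-injective (begin
  + x               ≡⟨ ↥ℕ→ℚ x ⟨
  ↥ (ℕ→ℚ x)         ≡⟨ cong ↥_ eq ⟩
  ↥ (ℕ→ℚ y)         ≡⟨ ↥ℕ→ℚ y ⟩
  + y               ∎)
  where
  open ≡-Reasoning
  ↥ℕ→ℚ : ∀ z → ↥ (ℕ→ℚ z) ≡ + z
  ↥ℕ→ℚ z = trans (sym (ℤP.*-identityʳ _))
    (trans (cong (↥ (ℕ→ℚ z) ℤ.*_) (sym (gcd-zeroʳ (+ z)))) (ℚP.↥-/ (+ z) 1))

module ∑ = SemiringSum (CommutativeRing.semiring ℚP.+-*-commutativeRing)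

Σ≡sum : ∀ {n} (f : Fin n → ℚ) → Σ f ≡ ∑.sum f
Σ≡sum {zero}  f = refl
Σ≡sum {suc n} f = cong (λ s → f zero + s) (Σ≡sum (λ i → f (suc i)))

Σ-cong : ∀ {n} {f g : Fin n → ℚ} → (∀ i → f i ≡ g i) → Σ f ≡ Σ g
Σ-cong {zero}  eq = refl
Σ-cong {suc n} eq = cong₂ _+_ (eq zero) (Σ-cong (λ i → eq (suc i)))

Σ-+ : ∀ {n} (f g : Fin n → ℚ) → Σ (λ i → f i + g i) ≡ Σ f + Σ g
Σ-+ f g = begin
  Σ (λ i → f i + g i)          ≡⟨ Σ≡sum (λ i → f i + g i) ⟩
  ∑.sum (λ i → f i + g i)      ≡⟨ ∑.∑-distrib-+ f g ⟩
  ∑.sum f + ∑.sum g            ≡⟨ cong₂ _+_ (Σ≡sum f) (Σ≡sum g) ⟨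
  Σ f + Σ g                    ∎
  where open ≡-Reasoning

Σ-*ˡ : ∀ {n} c (f : Fin n → ℚ) → Σ (λ i → c * f i) ≡ c * Σ f
Σ-*ˡ c f = begin
  Σ (λ i → c * f i)      ≡⟨ Σ≡sum (λ i → c * f i) ⟩
  ∑.sum (λ i → c * f i)  ≡⟨ ∑.*-distribˡ-sum c f ⟨
  c * ∑.sum f            ≡⟨ cong (c *_) (Σ≡sum f) ⟨
  c * Σ f                ∎
  where open ≡-Reasoning

Σ-*ʳ : ∀ {n} c (f : Fin n → ℚ) → Σ (λ i → f i * c) ≡ Σ f * c
Σ-*ʳ c f = begin
  Σ (λ i → f i * c)      ≡⟨ Σ≡sum (λ i → f i * c) ⟩
  ∑.sum (λ i → f i * c)  ≡⟨ ∑.*-distribʳ-sum c f ⟨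
  ∑.sum f * c            ≡⟨ cong (_* c) (Σ≡sum f) ⟨
  Σ f * c                ∎
  where open ≡-Reasoning

Σ-comm : ∀ {m n} (f : Fin m → Fin n → ℚ) → Σ (λ i → Σ (f i)) ≡ Σ (λ j → Σ (λ i → f i j))
Σ-comm f = begin
  Σ (λ i → Σ (f i))                 ≡⟨ Σ-cong (λ i → Σ≡sum (f i)) ⟩
  Σ (λ i → ∑.sum (f i))             ≡⟨ Σ≡sum (λ i → ∑.sum (f i)) ⟩
  ∑.sum (λ i → ∑.sum (f i))         ≡⟨ ∑.∑-comm f ⟩
  ∑.sum (λ j → ∑.sum (λ i → f i j)) ≡⟨ Σ≡sum (λ j → ∑.sum (λ i → f i j)) ⟨
  Σ (λ j → ∑.sum (λ i → f i j))     ≡⟨ Σ-cong (λ j → Σ≡sum (λ i → f i j)) ⟨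
  Σ (λ j → Σ (λ i → f i j))         ∎
  where open ≡-Reasoning

Σ-permute : ∀ {m n} (σ : Fin m ↔ Fin n) (f : Fin n → ℚ) → Σ f ≡ Σ (λ i → f (Inverse.to σ i))
Σ-permute σ f = trans (Σ≡sum f) (trans (∑.∑-permute f σ) (sym (Σ≡sum (λ i → f (Inverse.to σ i)))))

Σ-- : ∀ {n} (f g : Fin n → ℚ) → Σ (λ i → f i - g i) ≡ Σ f - Σ g
Σ-- {zero}  f g = refl
Σ-- {suc n} f g = begin
  (f zero - g zero) + Σ (λ i → f (suc i) - g (suc i))  ≡⟨ cong (λ s → (f zero - g zero) + s) (Σ-- (f ∘suc) (g ∘suc)) ⟩
  (f zero - g zero) + (Σ (f ∘suc) - Σ (g ∘suc))        ≡⟨ interchange (f zero) (g zero) _ _ ⟩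
  (f zero + Σ (f ∘suc)) - (g zero + Σ (g ∘suc))        ∎
  where
  open ≡-Reasoning
  _∘suc : (Fin (suc n) → ℚ) → Fin n → ℚ
  h ∘suc = λ i → h (suc i)
  interchange : ∀ a b c d → (a - b) + (c - d) ≡ (a + c) - (b + d)
  interchange = solve-∀ ℚ-ring

Σ-const : ∀ {n} c → Σ {n} (λ _ → c) ≡ ℕ→ℚ n * c
Σ-const {zero}  c = sym (ℚP.*-zeroˡ c)
Σ-const {suc n} c = begin
  c + Σ {n} (λ _ → c)     ≡⟨ cong (λ s → c + s) (Σ-const {n} c) ⟩
  c + ℕ→ℚ n * c           ≡⟨ distribute c (ℕ→ℚ n) ⟩
  (1ℚ + ℕ→ℚ n) * c        ≡⟨ cong (_* c) (ℕ→ℚ-+ 1 n) ⟨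
  ℕ→ℚ (suc n) * c         ∎
  where
  open ≡-Reasoning
  distribute : ∀ c m → c + m * c ≡ (1ℚ + m) * c
  distribute = solve-∀ ℚ-ring

Σ-zero : ∀ {n} → Σ {n} (λ _ → 0ℚ) ≡ 0ℚ
Σ-zero {n} = trans (Σ-const {n} 0ℚ) (ℚP.*-zeroʳ (ℕ→ℚ n))

Σ-δ : ∀ {n} (i : Fin n) (h : Fin n → ℚ) → Σ (λ k → if does (i ≟ k) then h k else 0ℚ) ≡ h i
Σ-δ {suc n} zero h = trans (cong (λ s → h zero + s) (Σ-zero {n})) (ℚP.+-identityʳ (h zero))
Σ-δ {suc n} (suc i) h = trans (ℚP.+-identityˡ _) (Σ-δ i (λ k → h (suc k)))

Σ-<ᵇ : ∀ a b (h : Bool → ℚ) → Σ {a +ℕ b} (λ k → h (toℕ k <ᵇ a)) ≡ ℕ→ℚ a * h true + ℕ→ℚ b * h false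
Σ-<ᵇ zero    b h = trans (Σ-const {b} (h false)) (no-first (h true) (ℕ→ℚ b * h false))
  where
  no-first : ∀ x y → y ≡ 0ℚ * x + y
  no-first = solve-∀ ℚ-ring
Σ-<ᵇ (suc a) b h = begin
  h true + Σ {a +ℕ b} (λ k → h (toℕ k <ᵇ a))    ≡⟨ cong (λ s → h true + s) (Σ-<ᵇ a b h) ⟩
  h true + (ℕ→ℚ a * h true + ℕ→ℚ b * h false)  ≡⟨ regroup (h true) (ℕ→ℚ a) (ℕ→ℚ b * h false) ⟩
  (1ℚ + ℕ→ℚ a) * h true + ℕ→ℚ b * h false      ≡⟨ cong (λ c → c * h true + ℕ→ℚ b * h false) (ℕ→ℚ-+ 1 a) ⟨
  ℕ→ℚ (suc a) * h true + ℕ→ℚ b * h false       ∎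
  where
  open ≡-Reasoning
  regroup : ∀ x m y → x + (m * x + y) ≡ (1ℚ + m) * x + y
  regroup = solve-∀ ℚ-ring

if-then-0 : ∀ b x → (if b then x else 0ℚ) ≡ (if b then 1ℚ else 0ℚ) * x
if-then-0 true  x = sym (ℚP.*-identityˡ x)
if-then-0 false x = sym (ℚP.*-zeroˡ x)

minus-zero : ∀ y t {s} → s ≡ 0ℚ → y - s * t ≡ y
minus-zero y t refl = zero-times y t
  where
  zero-times : ∀ y t → y - 0ℚ * t ≡ y
  zero-times = solve-∀ ℚ-ring

-- Matrices and the Penrose equations

-- Matrices are compared pointwise: without function extensionality the equations of
-- IsPseudoInverse can be used, but not established.
infix 4 _≈ₘ_
_≈ₘ_ : ∀ {n} → Matrix n → Matrix n → Set
A ≈ₘ B = ∀ i j → A i j ≡ B i j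

≈ₘ-setoid : ℕ → Setoid 0ℓ 0ℓ
≈ₘ-setoid n = record
  { Carrier       = Matrix n
  ; _≈_           = _≈ₘ_
  ; isEquivalence = record
    { refl  = λ i j → refl
    ; sym   = λ eq i j → sym (eq i j)
    ; trans = λ eq eq′ i j → trans (eq i j) (eq′ i j)
    }
  }

module ≈ₘ-Reasoning {n} = SetoidReasoning (≈ₘ-setoid n)

module _ {n : ℕ} where

  ⊗-cong : {A A′ B B′ : Matrix n} → A ≈ₘ A′ → B ≈ₘ B′ → A ⊗ B ≈ₘ A′ ⊗ B′
  ⊗-cong eqA eqB i j = Σ-cong (λ k → cong₂ _*_ (eqA i k) (eqB k j))

  ⊗-assoc : (A B C : Matrix n) → (A ⊗ B) ⊗ C ≈ₘ A ⊗ (B ⊗ C)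
  ⊗-assoc A B C i j = begin
    Σ (λ l → Σ (λ k → A i k * B k l) * C l j)  ≡⟨ Σ-cong (λ l → Σ-*ʳ (C l j) (λ k → A i k * B k l)) ⟨
    Σ (λ l → Σ (λ k → A i k * B k l * C l j))  ≡⟨ Σ-comm (λ l k → A i k * B k l * C l j) ⟩
    Σ (λ k → Σ (λ l → A i k * B k l * C l j))  ≡⟨ Σ-cong (λ k → Σ-cong (λ l → ℚP.*-assoc (A i k) (B k l) (C l j))) ⟩
    Σ (λ k → Σ (λ l → A i k * (B k l * C l j))) ≡⟨ Σ-cong (λ k → Σ-*ˡ (A i k) (λ l → B k l * C l j)) ⟩
    Σ (λ k → A i k * Σ (λ l → B k l * C l j))  ∎
    where open ≡-Reasoning

  ⊗-congˡ : {A A′ : Matrix n} (B : Matrix n) → A ≈ₘ A′ → A ⊗ B ≈ₘ A′ ⊗ B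
  ⊗-congˡ B eq i j = Σ-cong (λ k → cong (_* B k j) (eq i k))

  ⊗-congʳ : (A : Matrix n) {B B′ : Matrix n} → B ≈ₘ B′ → A ⊗ B ≈ₘ A ⊗ B′
  ⊗-congʳ A eq i j = Σ-cong (λ k → cong (A i k *_) (eq k j))

  transpose-⊗ : (A B : Matrix n) → transpose (A ⊗ B) ≈ₘ transpose B ⊗ transpose A
  transpose-⊗ A B i j = Σ-cong (λ k → ℚP.*-comm (A j k) (B k i))

  transpose-cong : {A B : Matrix n} → A ≈ₘ B → transpose A ≈ₘ transpose B
  transpose-cong eq i j = eq j i

record Penrose {n} (L X : Matrix n) : Set where
  field
    LXL≈L       : L ⊗ (X ⊗ L) ≈ₘ L
    XLX≈X       : X ⊗ (L ⊗ X) ≈ₘ X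
    LX-symmetric : transpose (L ⊗ X) ≈ₘ L ⊗ X
    XL-symmetric : transpose (X ⊗ L) ≈ₘ X ⊗ L

IsPseudoInverse⇒Penrose : ∀ {n} {L M : Matrix n} → IsPseudoInverse L M → Penrose L M
IsPseudoInverse⇒Penrose (LML , MLM , LM-sym , ML-sym) = record
  { LXL≈L        = pointwise LML
  ; XLX≈X        = pointwise MLM
  ; LX-symmetric = pointwise LM-sym
  ; XL-symmetric = pointwise ML-sym
  }
  where
  pointwise : ∀ {A B : Matrix _} → A ≡ B → A ≈ₘ B
  pointwise refl i j = refl

module _ {n} {L M X : Matrix n} (pM : Penrose L M) (pX : Penrose L X) where
  private
    module M = Penrose pM
    module X = Penrose pX
  open ≈ₘ-Reasoning

  Penrose-LX-unique : L ⊗ M ≈ₘ L ⊗ X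
  Penrose-LX-unique = begin
    L ⊗ M                                   ≈⟨ M.LX-symmetric ⟨
    transpose (L ⊗ M)                       ≈⟨ transpose-cong (⊗-congˡ M X.LXL≈L) ⟨
    transpose ((L ⊗ (X ⊗ L)) ⊗ M)           ≈⟨ transpose-cong (⊗-congˡ M (⊗-assoc L X L)) ⟨
    transpose (((L ⊗ X) ⊗ L) ⊗ M)           ≈⟨ transpose-cong (⊗-assoc (L ⊗ X) L M) ⟩
    transpose ((L ⊗ X) ⊗ (L ⊗ M))           ≈⟨ transpose-⊗ (L ⊗ X) (L ⊗ M) ⟩
    transpose (L ⊗ M) ⊗ transpose (L ⊗ X)   ≈⟨ ⊗-cong M.LX-symmetric X.LX-symmetric ⟩
    (L ⊗ M) ⊗ (L ⊗ X)                       ≈⟨ ⊗-assoc (L ⊗ M) L X ⟨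
    ((L ⊗ M) ⊗ L) ⊗ X                       ≈⟨ ⊗-congˡ X (⊗-assoc L M L) ⟩
    (L ⊗ (M ⊗ L)) ⊗ X                       ≈⟨ ⊗-congˡ X M.LXL≈L ⟩
    L ⊗ X                                   ∎

  Penrose-XL-unique : M ⊗ L ≈ₘ X ⊗ L
  Penrose-XL-unique = begin
    M ⊗ L                                   ≈⟨ M.XL-symmetric ⟨
    transpose (M ⊗ L)                       ≈⟨ transpose-cong (⊗-congʳ M X.LXL≈L) ⟨
    transpose (M ⊗ (L ⊗ (X ⊗ L)))           ≈⟨ transpose-cong (⊗-assoc M L (X ⊗ L)) ⟨
    transpose ((M ⊗ L) ⊗ (X ⊗ L))           ≈⟨ transpose-⊗ (M ⊗ L) (X ⊗ L) ⟩
    transpose (X ⊗ L) ⊗ transpose (M ⊗ L)   ≈⟨ ⊗-cong X.XL-symmetric M.XL-symmetric ⟩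
    (X ⊗ L) ⊗ (M ⊗ L)                       ≈⟨ ⊗-assoc X L (M ⊗ L) ⟩
    X ⊗ (L ⊗ (M ⊗ L))                       ≈⟨ ⊗-congʳ X M.LXL≈L ⟩
    X ⊗ L                                   ∎

  Penrose-unique : M ≈ₘ X
  Penrose-unique = begin
    M                  ≈⟨ M.XLX≈X ⟨
    M ⊗ (L ⊗ M)        ≈⟨ ⊗-congʳ M Penrose-LX-unique ⟩
    M ⊗ (L ⊗ X)        ≈⟨ ⊗-assoc M L X ⟨
    (M ⊗ L) ⊗ X        ≈⟨ ⊗-congˡ X Penrose-XL-unique ⟩
    (X ⊗ L) ⊗ X        ≈⟨ ⊗-assoc X L X ⟩
    X ⊗ (L ⊗ X)        ≈⟨ X.XLX≈X ⟩
    X                  ∎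

-- Centring and the biharmonic index of centred matrices

module _ {n : ℕ} where

  RowsSumToZero : Matrix n → Set
  RowsSumToZero A = ∀ i → Σ (A i) ≡ 0ℚ

  ColumnsSumToZero : Matrix n → Set
  ColumnsSumToZero A = ∀ j → Σ (λ i → A i j) ≡ 0ℚ

  laplacian-rowsSumToZero : (G : Graph n) → RowsSumToZero (laplacian G)
  laplacian-rowsSumToZero G i = begin
    Σ (laplacian G i)                                                ≡⟨ Σ-- (λ j → if does (i ≟ j) then degree G i else 0ℚ) (λ j → if G i j then 1ℚ else 0ℚ) ⟩
    Σ (λ j → if does (i ≟ j) then degree G i else 0ℚ) - degree G i  ≡⟨ cong (_- degree G i) (Σ-δ i (λ _ → degree G i)) ⟩
    degree G i - degree G i                                          ≡⟨ ℚP.+-inverseʳ (degree G i) ⟩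
    0ℚ                                                               ∎
    where open ≡-Reasoning

  ⊗-rowsSumToZero : (A : Matrix n) {B : Matrix n} → RowsSumToZero B → RowsSumToZero (A ⊗ B)
  ⊗-rowsSumToZero A {B} rows i = begin
    Σ (λ j → Σ (λ k → A i k * B k j))  ≡⟨ Σ-comm (λ j k → A i k * B k j) ⟩
    Σ (λ k → Σ (λ j → A i k * B k j))  ≡⟨ Σ-cong (λ k → Σ-*ˡ (A i k) (B k)) ⟩
    Σ (λ k → A i k * Σ (B k))          ≡⟨ Σ-cong (λ k → trans (cong (A i k *_) (rows k)) (ℚP.*-zeroʳ (A i k))) ⟩
    Σ {n} (λ _ → 0ℚ)                   ≡⟨ Σ-zero {n} ⟩
    0ℚ                                 ∎
    where open ≡-Reasoning

  ⊗-columnsSumToZero : {A : Matrix n} (B : Matrix n) → ColumnsSumToZero A → ColumnsSumToZero (A ⊗ B)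
  ⊗-columnsSumToZero {A} B cols j = begin
    Σ (λ i → Σ (λ k → A i k * B k j))  ≡⟨ Σ-comm (λ i k → A i k * B k j) ⟩
    Σ (λ k → Σ (λ i → A i k * B k j))  ≡⟨ Σ-cong (λ k → Σ-*ʳ (B k j) (λ i → A i k)) ⟩
    Σ (λ k → Σ (λ i → A i k) * B k j)  ≡⟨ Σ-cong (λ k → trans (cong (_* B k j) (cols k)) (ℚP.*-zeroˡ (B k j))) ⟩
    Σ {n} (λ _ → 0ℚ)                   ≡⟨ Σ-zero {n} ⟩
    0ℚ                                 ∎
    where open ≡-Reasoning

  δ : Fin n → Fin n → ℚ
  δ i j = if does (i ≟ j) then 1ℚ else 0ℚ

  δ-sym : ∀ i j → δ i j ≡ δ j i
  δ-sym i j with i ≟ j | j ≟ i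
  ... | yes _    | yes _    = refl
  ... | yes refl | no j≢i   = contradiction refl j≢i
  ... | no i≢j   | yes refl = contradiction refl i≢j
  ... | no _     | no _     = refl

  Σ-δ* : ∀ i (f : Fin n → ℚ) → Σ (λ k → δ i k * f k) ≡ f i
  Σ-δ* i f = trans (Σ-cong δ*) (Σ-δ i f)
    where
    δ* : ∀ k → δ i k * f k ≡ (if does (i ≟ k) then f k else 0ℚ)
    δ* k with does (i ≟ k)
    ... | true  = ℚP.*-identityˡ (f k)
    ... | false = ℚP.*-zeroˡ (f k)

  Σ-*δ : ∀ j (f : Fin n → ℚ) → Σ (λ k → f k * δ k j) ≡ f j
  Σ-*δ j f = trans (Σ-cong (λ k → trans (ℚP.*-comm (f k) (δ k j)) (cong (_* f k) (δ-sym k j)))) (Σ-δ* j f)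

  δ-dichotomy : ∀ i j → (δ i j ≡ 1ℚ × i ≡ j) ⊎ (δ i j ≡ 0ℚ × (i ≡ j → ⊥))
  δ-dichotomy i j with i ≟ j
  ... | yes i≡j = inj₁ (refl , i≡j)
  ... | no  i≢j = inj₂ (refl , i≢j)

  offDiagonal-split : ∀ (h : Fin n → Fin n → ℚ) i j →
    (if does (i ≟ j) then 0ℚ else h i j) ≡ h i j - δ i j * h j j
  offDiagonal-split h i j with i ≟ j
  ... | yes refl = sym (x-1x≡0 (h i i))
    where
    x-1x≡0 : ∀ x → x - 1ℚ * x ≡ 0ℚ
    x-1x≡0 = solve-∀ ℚ-ring
  ... | no  _    = sym (x-0x≡x (h i j) (h j j))
    where
    x-0x≡x : ∀ x y → x - 0ℚ * y ≡ x
    x-0x≡x = solve-∀ ℚ-ring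

  δ-* : ∀ i j (f : Fin n → ℚ) → δ i j * f i ≡ δ i j * f j
  δ-* i j f with δ-dichotomy i j
  ... | inj₁ (_ , refl)    = refl
  ... | inj₂ (δij≡0 , _)   = trans (cong (_* f i) δij≡0) (trans (ℚP.*-zeroˡ (f i))
                               (sym (trans (cong (_* f j) δij≡0) (ℚP.*-zeroˡ (f j)))))

  [δ-σ]⊗-columnsSumToZero : (σ : Fin n → ℚ) {Y : Matrix n} → ColumnsSumToZero Y →
    (λ i j → δ i j - σ i) ⊗ Y ≈ₘ Y
  [δ-σ]⊗-columnsSumToZero σ {Y} cols i j = begin
    Σ (λ k → (δ i k - σ i) * Y k j)                  ≡⟨ Σ-cong (λ k → [y-z]x≈yx-zx (Y k j) (δ i k) (σ i)) ⟩
    Σ (λ k → δ i k * Y k j - σ i * Y k j)            ≡⟨ Σ-- (λ k → δ i k * Y k j) (λ k → σ i * Y k j) ⟩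
    Σ (λ k → δ i k * Y k j) - Σ (λ k → σ i * Y k j)  ≡⟨ cong₂ _-_ (Σ-δ* i (λ k → Y k j)) (trans (Σ-*ˡ (σ i) (λ k → Y k j)) (ℚP.*-comm (σ i) _)) ⟩
    Y i j - Σ (λ k → Y k j) * σ i                    ≡⟨ minus-zero (Y i j) (σ i) (cols j) ⟩
    Y i j                                            ∎
    where open ≡-Reasoning

  centring : ℚ → Matrix n
  centring t i j = δ i j - t

  centring-symmetric : ∀ t → transpose (centring t) ≈ₘ centring t
  centring-symmetric t i j = cong (_- t) (δ-sym j i)

  ⊗-centring : ∀ t (Y : Matrix n) → Y ⊗ centring t ≈ₘ λ i j → Y i j - Σ (Y i) * t
  ⊗-centring t Y i j = begin
    Σ (λ k → Y i k * (δ k j - t))            ≡⟨ Σ-cong (λ k → x[y-z]≈xy-xz (Y i k) (δ k j) t) ⟩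
    Σ (λ k → Y i k * δ k j - Y i k * t)      ≡⟨ Σ-- (λ k → Y i k * δ k j) (λ k → Y i k * t) ⟩
    Σ (λ k → Y i k * δ k j) - Σ (λ k → Y i k * t)  ≡⟨ cong₂ _-_ (Σ-*δ j (Y i)) (Σ-*ʳ t (Y i)) ⟩
    Y i j - Σ (Y i) * t                      ∎
    where open ≡-Reasoning

  centring-⊗ : ∀ t (Y : Matrix n) → centring t ⊗ Y ≈ₘ λ i j → Y i j - Σ (λ k → Y k j) * t
  centring-⊗ t Y i j = begin
    Σ (λ k → (δ i k - t) * Y k j)            ≡⟨ Σ-cong (λ k → [y-z]x≈yx-zx (Y k j) (δ i k) t) ⟩
    Σ (λ k → δ i k * Y k j - t * Y k j)      ≡⟨ Σ-- (λ k → δ i k * Y k j) (λ k → t * Y k j) ⟩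
    Σ (λ k → δ i k * Y k j) - Σ (λ k → t * Y k j)  ≡⟨ cong₂ _-_ (Σ-δ* i (λ k → Y k j)) (Σ-*ˡ t (λ k → Y k j)) ⟩
    Y i j - t * Σ (λ k → Y k j)              ≡⟨ cong (λ s → Y i j - s) (ℚP.*-comm t (Σ (λ k → Y k j))) ⟩
    Y i j - Σ (λ k → Y k j) * t              ∎
    where open ≡-Reasoning

  ⊗-centring-rowsSumToZero : ∀ t {Y : Matrix n} → RowsSumToZero Y → Y ⊗ centring t ≈ₘ Y
  ⊗-centring-rowsSumToZero t {Y} rows i j = trans (⊗-centring t Y i j) (minus-zero (Y i j) t (rows i))

  BH-cong : {M X : Matrix n} → M ≈ₘ X → BH M ≡ BH X
  BH-cong eq = cong (½ *_) (Σ-cong λ u → Σ-cong λ v → Σ-cong λ k →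
    cong₂ (λ p q → (p - q) * (p - q)) (eq k u) (eq k v))

  sumSq : (Fin n → ℚ) → ℚ
  sumSq x = Σ (λ i → x i * x i)

  Σ-differences² : (x : Fin n → ℚ) → Σ x ≡ 0ℚ →
    Σ (λ u → Σ (λ v → (x u - x v) * (x u - x v))) ≡ (ℕ→ℚ n + ℕ→ℚ n) * sumSq x
  Σ-differences² x Σx≡0 = begin
    Σ (λ u → Σ (λ v → (x u - x v) * (x u - x v)))  ≡⟨ Σ-cong row ⟩
    Σ (λ u → ℕ→ℚ n * (x u * x u) + sumSq x)        ≡⟨ Σ-+ (λ u → ℕ→ℚ n * (x u * x u)) (λ _ → sumSq x) ⟩
    Σ (λ u → ℕ→ℚ n * (x u * x u)) + Σ {n} (λ _ → sumSq x)
      ≡⟨ cong₂ _+_ (Σ-*ˡ (ℕ→ℚ n) (λ u → x u * x u)) (Σ-const {n} (sumSq x)) ⟩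
    ℕ→ℚ n * sumSq x + ℕ→ℚ n * sumSq x              ≡⟨ ℚP.*-distribʳ-+ (sumSq x) (ℕ→ℚ n) (ℕ→ℚ n) ⟨
    (ℕ→ℚ n + ℕ→ℚ n) * sumSq x                      ∎
    where
    open ≡-Reasoning
    square-difference : ∀ a b → (a - b) * (a - b) ≡ (a * a + b * b) - (a + a) * b
    square-difference = solve-∀ ℚ-ring
    cancel : ∀ p q c → (p + q) - c * 0ℚ ≡ p + q
    cancel = solve-∀ ℚ-ring
    row : ∀ u → Σ (λ v → (x u - x v) * (x u - x v)) ≡ ℕ→ℚ n * (x u * x u) + sumSq x
    row u = begin
      Σ (λ v → (x u - x v) * (x u - x v))                   ≡⟨ Σ-cong (λ v → square-difference (x u) (x v)) ⟩
      Σ (λ v → (x u * x u + x v * x v) - (x u + x u) * x v)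
        ≡⟨ Σ-- (λ v → x u * x u + x v * x v) (λ v → (x u + x u) * x v) ⟩
      Σ (λ v → x u * x u + x v * x v) - Σ (λ v → (x u + x u) * x v)
        ≡⟨ cong₂ _-_ (Σ-+ (λ _ → x u * x u) (λ v → x v * x v)) (Σ-*ˡ (x u + x u) x) ⟩
      (Σ {n} (λ _ → x u * x u) + sumSq x) - (x u + x u) * Σ x
        ≡⟨ cong₂ (λ p q → (p + sumSq x) - (x u + x u) * q) (Σ-const {n} (x u * x u)) Σx≡0 ⟩
      (ℕ→ℚ n * (x u * x u) + sumSq x) - (x u + x u) * 0ℚ    ≡⟨ cancel (ℕ→ℚ n * (x u * x u)) (sumSq x) (x u + x u) ⟩
      ℕ→ℚ n * (x u * x u) + sumSq x                         ∎

  BH-rowsSumToZero : {Y : Matrix n} → RowsSumToZero Y → BH Y ≡ ℕ→ℚ n * Σ (λ k → sumSq (Y k))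
  BH-rowsSumToZero {Y} rows = begin
    ½ * Σ (λ u → Σ (λ v → Σ (λ k → d k u v)))     ≡⟨ cong (½ *_) (Σ-cong (λ u → Σ-comm (λ v k → d k u v))) ⟩
    ½ * Σ (λ u → Σ (λ k → Σ (λ v → d k u v)))     ≡⟨ cong (½ *_) (Σ-comm (λ u k → Σ (λ v → d k u v))) ⟩
    ½ * Σ (λ k → Σ (λ u → Σ (λ v → d k u v)))     ≡⟨ cong (½ *_) (Σ-cong (λ k → Σ-differences² (Y k) (rows k))) ⟩
    ½ * Σ (λ k → (ℕ→ℚ n + ℕ→ℚ n) * sumSq (Y k))  ≡⟨ cong (½ *_) (Σ-*ˡ (ℕ→ℚ n + ℕ→ℚ n) (λ k → sumSq (Y k))) ⟩
    ½ * ((ℕ→ℚ n + ℕ→ℚ n) * Σ (λ k → sumSq (Y k))) ≡⟨ halve (ℕ→ℚ n) (Σ (λ k → sumSq (Y k))) ⟩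
    ℕ→ℚ n * Σ (λ k → sumSq (Y k))                 ∎
    where
    open ≡-Reasoning
    d : Fin n → Fin n → Fin n → ℚ
    d k u v = (Y k u - Y k v) * (Y k u - Y k v)
    halve : ∀ m s → ½ * ((m + m) * s) ≡ m * s
    halve = solve-∀ ℚ-ring

  rowSum : Matrix n → Fin n → ℚ
  rowSum F i = Σ (F i)

  Σ-linear₃ : (f g h : Fin n → ℚ) → Σ (λ i → f i - g i - h i) ≡ Σ f - Σ g - Σ h
  Σ-linear₃ f g h = trans (Σ-- (λ i → f i - g i) h) (cong (_- Σ h) (Σ-- f g))

  Σ-linear₄ : (f g h l : Fin n → ℚ) → Σ (λ i → f i - g i - h i + l i) ≡ Σ f - Σ g - Σ h + Σ l
  Σ-linear₄ f g h l = trans (Σ-+ (λ i → f i - g i - h i) l) (cong (_+ Σ l) (Σ-linear₃ f g h))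

  Σ-pairing : (G F : Matrix n) (α β : Fin n → ℚ) →
    Σ (λ k → Σ (λ u → G k u * (F k u - α k - β u)))
      ≡ Σ (λ k → Σ (λ u → G k u * F k u)) - Σ (λ k → α k * Σ (G k)) - Σ (λ u → β u * Σ (λ k → G k u))
  Σ-pairing G F α β = begin
    Σ (λ k → Σ (λ u → G k u * (F k u - α k - β u)))
      ≡⟨ Σ-cong (λ k → Σ-cong (λ u → expand (G k u) (F k u) (α k) (β u))) ⟩
    Σ (λ k → Σ (λ u → G k u * F k u - α k * G k u - β u * G k u))
      ≡⟨ Σ-cong (λ k → Σ-linear₃ (λ u → G k u * F k u) (λ u → α k * G k u) (λ u → β u * G k u)) ⟩
    Σ (λ k → Σ (λ u → G k u * F k u) - Σ (λ u → α k * G k u) - Σ (λ u → β u * G k u))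
      ≡⟨ Σ-linear₃ (λ k → Σ (λ u → G k u * F k u)) (λ k → Σ (λ u → α k * G k u)) (λ k → Σ (λ u → β u * G k u)) ⟩
    Σ (λ k → Σ (λ u → G k u * F k u)) - Σ (λ k → Σ (λ u → α k * G k u)) - Σ (λ k → Σ (λ u → β u * G k u))
      ≡⟨ cong₂ (λ p q → Σ (λ k → Σ (λ u → G k u * F k u)) - p - q)
           (Σ-cong (λ k → Σ-*ˡ (α k) (G k)))
           (trans (Σ-comm (λ k u → β u * G k u)) (Σ-cong (λ u → Σ-*ˡ (β u) (λ k → G k u)))) ⟩
    Σ (λ k → Σ (λ u → G k u * F k u)) - Σ (λ k → α k * Σ (G k)) - Σ (λ u → β u * Σ (λ k → G k u)) ∎
    where
    open ≡-Reasoning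
    expand : ∀ g f a b → g * (f - a - b) ≡ g * f - a * g - b * g
    expand = solve-∀ ℚ-ring

  Σ-pairing-centred : {G : Matrix n} (F : Matrix n) (α β : Fin n → ℚ) →
    RowsSumToZero G → ColumnsSumToZero G →
    Σ (λ k → Σ (λ u → G k u * (F k u - α k - β u))) ≡ Σ (λ k → Σ (λ u → G k u * F k u))
  Σ-pairing-centred {G} F α β rows cols = begin
    Σ (λ k → Σ (λ u → G k u * (F k u - α k - β u)))  ≡⟨ Σ-pairing G F α β ⟩
    ⟨G,F⟩ - Σ (λ k → α k * Σ (G k)) - Σ (λ u → β u * Σ (λ k → G k u))
      ≡⟨ cong₂ (λ p q → ⟨G,F⟩ - p - q) (vanish α (λ k → Σ (G k)) rows) (vanish β (λ u → Σ (λ k → G k u)) cols) ⟩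
    ⟨G,F⟩ - 0ℚ - 0ℚ                                   ≡⟨ minus-zeros ⟨G,F⟩ ⟩
    ⟨G,F⟩                                             ∎
    where
    open ≡-Reasoning
    ⟨G,F⟩ = Σ (λ k → Σ (λ u → G k u * F k u))
    vanish : (γ s : Fin n → ℚ) → (∀ k → s k ≡ 0ℚ) → Σ (λ k → γ k * s k) ≡ 0ℚ
    vanish γ s s≡0 = trans (Σ-cong (λ k → trans (cong (γ k *_) (s≡0 k)) (ℚP.*-zeroʳ (γ k)))) (Σ-zero {n})
    minus-zeros : ∀ x → x - 0ℚ - 0ℚ ≡ x
    minus-zeros = solve-∀ ℚ-ring

module Centring {n : ℕ} {t : ℚ} (n*t≡1 : ℕ→ℚ n * t ≡ 1ℚ) where

  centring-columnsSumToZero : ColumnsSumToZero (centring {n} t)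
  centring-columnsSumToZero j = begin
    Σ (λ i → δ i j - t)                        ≡⟨ Σ-- (λ i → δ i j) (λ _ → t) ⟩
    Σ (λ i → δ i j) - Σ {n} (λ _ → t)          ≡⟨ cong₂ _-_ Σδ≡1 (Σ-const {n} t) ⟩
    1ℚ - ℕ→ℚ n * t                             ≡⟨ cong (λ s → 1ℚ - s) n*t≡1 ⟩
    1ℚ - 1ℚ                                    ≡⟨ ℚP.+-inverseʳ 1ℚ ⟩
    0ℚ                                         ∎
    where
    open ≡-Reasoning
    Σδ≡1 : Σ (λ i → δ i j) ≡ 1ℚ
    Σδ≡1 = trans (Σ-cong (λ i → sym (ℚP.*-identityˡ (δ i j)))) (Σ-*δ j (λ _ → 1ℚ))

  centring-rowsSumToZero : RowsSumToZero (centring {n} t)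
  centring-rowsSumToZero i = trans (Σ-cong (λ j → centring-symmetric t j i)) (centring-columnsSumToZero i)

  doubleCentre : Matrix n → Matrix n
  doubleCentre E = centring t ⊗ (E ⊗ centring t)

  doubleCentre-rowsSumToZero : (E : Matrix n) → RowsSumToZero (doubleCentre E)
  doubleCentre-rowsSumToZero E =
    ⊗-rowsSumToZero (centring t) (⊗-rowsSumToZero E centring-rowsSumToZero)

  doubleCentre-columnsSumToZero : (E : Matrix n) → ColumnsSumToZero (doubleCentre E)
  doubleCentre-columnsSumToZero E = ⊗-columnsSumToZero (E ⊗ centring t) centring-columnsSumToZero

  doubleCentre-symmetric : {E : Matrix n} → transpose E ≈ₘ E → transpose (doubleCentre E) ≈ₘ doubleCentre E
  doubleCentre-symmetric {E} E-sym = begin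
    transpose (P ⊗ (E ⊗ P))                   ≈⟨ transpose-⊗ P (E ⊗ P) ⟩
    transpose (E ⊗ P) ⊗ transpose P           ≈⟨ ⊗-congˡ (transpose P) (transpose-⊗ E P) ⟩
    (transpose P ⊗ transpose E) ⊗ transpose P ≈⟨ ⊗-cong (⊗-cong (centring-symmetric t) E-sym) (centring-symmetric t) ⟩
    (P ⊗ E) ⊗ P                               ≈⟨ ⊗-assoc P E P ⟩
    P ⊗ (E ⊗ P)                               ∎
    where
    open ≈ₘ-Reasoning
    P = centring t

  Penrose-doubleCentre : {L E : Matrix n} (σ : Fin n → ℚ) →
    transpose L ≈ₘ L → RowsSumToZero L → transpose E ≈ₘ E →
    L ⊗ E ≈ₘ (λ i j → δ i j - σ i) → Penrose L (doubleCentre E)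
  Penrose-doubleCentre {L} {E} σ L-sym L-rows E-sym LE≈I-σ1ᵀ = record
    { LXL≈L        = begin
        L ⊗ (X ⊗ L)        ≈⟨ ⊗-congʳ L XL≈P ⟩
        L ⊗ P              ≈⟨ LP≈L ⟩
        L                  ∎
    ; XLX≈X        = begin
        X ⊗ (L ⊗ X)        ≈⟨ ⊗-congʳ X LX≈P ⟩
        X ⊗ P              ≈⟨ ⊗-centring-rowsSumToZero t (doubleCentre-rowsSumToZero E) ⟩
        X                  ∎
    ; LX-symmetric = begin
        transpose (L ⊗ X)  ≈⟨ transpose-cong LX≈P ⟩
        transpose P        ≈⟨ centring-symmetric t ⟩
        P                  ≈⟨ LX≈P ⟨
        L ⊗ X              ∎
    ; XL-symmetric = begin
        transpose (X ⊗ L)  ≈⟨ transpose-cong XL≈P ⟩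
        transpose P        ≈⟨ centring-symmetric t ⟩
        P                  ≈⟨ XL≈P ⟨
        X ⊗ L              ∎
    }
    where
    open ≈ₘ-Reasoning
    P = centring t
    X = doubleCentre E

    LP≈L : L ⊗ P ≈ₘ L
    LP≈L = ⊗-centring-rowsSumToZero t L-rows

    LX≈P : L ⊗ X ≈ₘ P
    LX≈P = begin
      L ⊗ (P ⊗ (E ⊗ P))                ≈⟨ ⊗-assoc L P (E ⊗ P) ⟨
      (L ⊗ P) ⊗ (E ⊗ P)                ≈⟨ ⊗-congˡ (E ⊗ P) LP≈L ⟩
      L ⊗ (E ⊗ P)                      ≈⟨ ⊗-assoc L E P ⟨
      (L ⊗ E) ⊗ P                      ≈⟨ ⊗-congˡ P LE≈I-σ1ᵀ ⟩
      (λ i j → δ i j - σ i) ⊗ P        ≈⟨ [δ-σ]⊗-columnsSumToZero σ centring-columnsSumToZero ⟩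
      P                                ∎

    XL≈P : X ⊗ L ≈ₘ P
    XL≈P = begin
      X ⊗ L                            ≈⟨ ⊗-cong (doubleCentre-symmetric E-sym) L-sym ⟨
      transpose X ⊗ transpose L        ≈⟨ transpose-⊗ L X ⟨
      transpose (L ⊗ X)                ≈⟨ transpose-cong LX≈P ⟩
      transpose P                      ≈⟨ centring-symmetric t ⟩
      P                                ∎

  doubleCentre-entry : {F : Matrix n} → transpose F ≈ₘ F → ∀ k u →
    doubleCentre F k u ≡ F k u - rowSum F k * t - (rowSum F u - Σ (rowSum F) * t) * t
  doubleCentre-entry {F} F-sym k u = begin
    (P ⊗ (F ⊗ P)) k u                              ≡⟨ centring-⊗ t (F ⊗ P) k u ⟩
    (F ⊗ P) k u - Σ (λ i → (F ⊗ P) i u) * t        ≡⟨ cong₂ (λ p q → p - q * t) (⊗-centring t F k u) column ⟩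
    F k u - rowSum F k * t - (rowSum F u - Σ (rowSum F) * t) * t  ∎
    where
    open ≡-Reasoning
    P = centring t
    column : Σ (λ i → (F ⊗ P) i u) ≡ rowSum F u - Σ (rowSum F) * t
    column = begin
      Σ (λ i → (F ⊗ P) i u)                  ≡⟨ Σ-cong (λ i → ⊗-centring t F i u) ⟩
      Σ (λ i → F i u - rowSum F i * t)       ≡⟨ Σ-- (λ i → F i u) (λ i → rowSum F i * t) ⟩
      Σ (λ i → F i u) - Σ (λ i → rowSum F i * t)
        ≡⟨ cong₂ _-_ (Σ-cong (λ i → F-sym u i)) (Σ-*ʳ t (rowSum F)) ⟩
      rowSum F u - Σ (rowSum F) * t          ∎

  sumSq-doubleCentre : {F : Matrix n} → transpose F ≈ₘ F →
    Σ (λ k → sumSq (doubleCentre F k))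
      ≡ Σ (λ k → sumSq (F k)) - (t + t) * sumSq (rowSum F) + (t * t) * (Σ (rowSum F) * Σ (rowSum F))
  sumSq-doubleCentre {F} F-sym = begin
    Σ (λ k → Σ (λ u → Y k u * Y k u))                  ≡⟨ Σ-cong (λ k → Σ-cong (λ u → cong (Y k u *_) (entry k u))) ⟩
    Σ (λ k → Σ (λ u → Y k u * (F k u - α k - β u)))    ≡⟨ Σ-pairing-centred F α β (doubleCentre-rowsSumToZero F) (doubleCentre-columnsSumToZero F) ⟩
    Σ (λ k → Σ (λ u → Y k u * F k u))                  ≡⟨ Σ-cong (λ k → Σ-cong (λ u → trans (ℚP.*-comm (Y k u) (F k u)) (cong (F k u *_) (entry k u)))) ⟩
    Σ (λ k → Σ (λ u → F k u * (F k u - α k - β u)))    ≡⟨ Σ-pairing F F α β ⟩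
    Σ (λ k → sumSq (F k)) - Σ (λ k → α k * r k) - Σ (λ u → β u * Σ (λ k → F k u))
      ≡⟨ cong (λ c → Σ (λ k → sumSq (F k)) - Σ (λ k → α k * r k) - c) (Σ-cong (λ u → cong (β u *_) (Σ-cong (λ k → F-sym u k)))) ⟩
    Σ (λ k → sumSq (F k)) - Σ (λ k → α k * r k) - Σ (λ u → β u * r u)
      ≡⟨ cong₂ (λ p q → Σ (λ k → sumSq (F k)) - p - q) Σαr Σβr ⟩
    Σ (λ k → sumSq (F k)) - t * sumSq r - (t * sumSq r - (t * t) * (S * S))  ≡⟨ collect (Σ (λ k → sumSq (F k))) t (sumSq r) (S * S) ⟩
    Σ (λ k → sumSq (F k)) - (t + t) * sumSq r + (t * t) * (S * S)  ∎
    where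
    open ≡-Reasoning
    Y = doubleCentre F
    r = rowSum F
    S = Σ r
    α β : Fin n → ℚ
    α k = r k * t
    β u = (r u - S * t) * t
    entry = doubleCentre-entry F-sym
    weight-α : ∀ x t → (x * t) * x ≡ t * (x * x)
    weight-α = solve-∀ ℚ-ring
    weight-β : ∀ x S t → ((x - S * t) * t) * x ≡ t * (x * x) - (t * t * S) * x
    weight-β = solve-∀ ℚ-ring
    collect : ∀ A t R Q → A - t * R - (t * R - (t * t) * Q) ≡ A - (t + t) * R + (t * t) * Q
    collect = solve-∀ ℚ-ring
    Σαr : Σ (λ k → α k * r k) ≡ t * sumSq r
    Σαr = trans (Σ-cong (λ k → weight-α (r k) t)) (Σ-*ˡ t (λ k → r k * r k))
    Σβr : Σ (λ u → β u * r u) ≡ t * sumSq r - (t * t) * (S * S)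
    Σβr = begin
      Σ (λ u → β u * r u)                                ≡⟨ Σ-cong (λ u → weight-β (r u) S t) ⟩
      Σ (λ u → t * (r u * r u) - (t * t * S) * r u)      ≡⟨ Σ-- (λ u → t * (r u * r u)) (λ u → (t * t * S) * r u) ⟩
      Σ (λ u → t * (r u * r u)) - Σ (λ u → (t * t * S) * r u)
        ≡⟨ cong₂ _-_ (Σ-*ˡ t (λ u → r u * r u)) (Σ-*ˡ (t * t * S) r) ⟩
      t * sumSq r - (t * t * S) * S                       ≡⟨ cong (λ c → t * sumSq r - c) (ℚP.*-assoc (t * t) S S) ⟩
      t * sumSq r - (t * t) * (S * S)                     ∎

-- The value of BH(S(a,b)) when a + b + 2 = n and ab = p.
starBH : (n : ℕ) .{{_ : NonZero n}} → ℕ → ℚ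
starBH n p = ℕ→ℚ (n *ℕ n +ℕ 4 *ℕ p) - ℕ→ℚ (2 *ℕ n) + (+ ((p +ℕ 1) *ℕ (p +ℕ 1))) / n

starBH-cast : ∀ n .{{_ : NonZero n}} p → starBH n p
  ≡ ℕ→ℚ n * ℕ→ℚ n + 4ℚ * ℕ→ℚ p - 2ℚ * ℕ→ℚ n + (ℕ→ℚ p + 1ℚ) * (ℕ→ℚ p + 1ℚ) * ((+ 1) / n)
starBH-cast n p = shape first (ℕ→ℚ-* 2 n) third
  where
  shape : ∀ {x x′ y y′ z z′ : ℚ} → x ≡ x′ → y ≡ y′ → z ≡ z′ → x - y + z ≡ x′ - y′ + z′
  shape refl refl refl = refl
  first : ℕ→ℚ (n *ℕ n +ℕ 4 *ℕ p) ≡ ℕ→ℚ n * ℕ→ℚ n + 4ℚ * ℕ→ℚ p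
  first = trans (ℕ→ℚ-+ (n *ℕ n) (4 *ℕ p)) (cong₂ _+_ (ℕ→ℚ-* n n) (ℕ→ℚ-* 4 p))
  third : (+ ((p +ℕ 1) *ℕ (p +ℕ 1))) / n ≡ (ℕ→ℚ p + 1ℚ) * (ℕ→ℚ p + 1ℚ) * ((+ 1) / n)
  third = trans (/-as-* ((p +ℕ 1) *ℕ (p +ℕ 1)) n) (cong (_* ((+ 1) / n))
    (trans (ℕ→ℚ-* (p +ℕ 1) (p +ℕ 1)) (cong₂ _*_ (ℕ→ℚ-+ p 1) (ℕ→ℚ-+ p 1))))

starBH-increment : (n : ℕ) .{{_ : NonZero n}} → ℕ → ℕ → ℚ
starBH-increment n p d = ℕ→ℚ (4 *ℕ d) + (+ (d *ℕ (2 *ℕ p +ℕ d +ℕ 2))) / n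

starBH-+ : ∀ n .{{_ : NonZero n}} p d → starBH n (p +ℕ d) ≡ starBH n p + starBH-increment n p d
starBH-+ n p d = begin
  starBH n (p +ℕ d)
    ≡⟨ starBH-cast n (p +ℕ d) ⟩
  N * N + 4ℚ * ℕ→ℚ (p +ℕ d) - 2ℚ * N + (ℕ→ℚ (p +ℕ d) + 1ℚ) * (ℕ→ℚ (p +ℕ d) + 1ℚ) * t
    ≡⟨ cong (λ x → N * N + 4ℚ * x - 2ℚ * N + (x + 1ℚ) * (x + 1ℚ) * t) (ℕ→ℚ-+ p d) ⟩
  N * N + 4ℚ * (P + D) - 2ℚ * N + (P + D + 1ℚ) * (P + D + 1ℚ) * t
    ≡⟨ split N P D t ⟩
  (N * N + 4ℚ * P - 2ℚ * N + (P + 1ℚ) * (P + 1ℚ) * t) + (4ℚ * D + D * (2ℚ * P + D + 2ℚ) * t)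
    ≡⟨ cong₂ _+_ (starBH-cast n p) increment ⟨
  starBH n p + starBH-increment n p d
    ∎
  where
  open ≡-Reasoning
  N = ℕ→ℚ n
  P = ℕ→ℚ p
  D = ℕ→ℚ d
  t = (+ 1) / n
  split : ∀ N P D t → N * N + 4ℚ * (P + D) - 2ℚ * N + (P + D + 1ℚ) * (P + D + 1ℚ) * t
    ≡ (N * N + 4ℚ * P - 2ℚ * N + (P + 1ℚ) * (P + 1ℚ) * t) + (4ℚ * D + D * (2ℚ * P + D + 2ℚ) * t)
  split = solve-∀ ℚ-ring
  increment : starBH-increment n p d ≡ 4ℚ * D + D * (2ℚ * P + D + 2ℚ) * t
  increment = cong₂ _+_ (ℕ→ℚ-* 4 d)
    (trans (/-as-* (d *ℕ (2 *ℕ p +ℕ d +ℕ 2)) n) (cong (_* t)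
      (trans (ℕ→ℚ-* d (2 *ℕ p +ℕ d +ℕ 2)) (cong (D *_)
        (trans (ℕ→ℚ-+ (2 *ℕ p +ℕ d) 2) (cong (_+ 2ℚ)
          (trans (ℕ→ℚ-+ (2 *ℕ p) d) (cong (_+ D) (ℕ→ℚ-* 2 p)))))))))

starBH-increment-nonNeg : ∀ n .{{_ : NonZero n}} p d → 0ℚ ≤ starBH-increment n p d
starBH-increment-nonNeg n p d = ℚP.nonNegative⁻¹ (starBH-increment n p d)
  {{ℚP.nonNeg+nonNeg⇒nonNeg (ℕ→ℚ (4 *ℕ d)) {{ℚP.normalize-nonNeg (4 *ℕ d) 1}} ((+ m) / n) {{ℚP.normalize-nonNeg m n}}}}
  where m = d *ℕ (2 *ℕ p +ℕ d +ℕ 2)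

starBH-increment-pos : ∀ n .{{_ : NonZero n}} p d → 0ℚ < starBH-increment n p (suc d)
starBH-increment-pos n p d = ℚP.positive⁻¹ (starBH-increment n p (suc d))
  {{ℚP.pos+nonNeg⇒pos (ℕ→ℚ (4 *ℕ suc d)) {{ℚP.normalize-pos (4 *ℕ suc d) 1}} ((+ m) / n) {{ℚP.normalize-nonNeg m n}}}}
  where m = suc d *ℕ (2 *ℕ p +ℕ suc d +ℕ 2)

starBH-mono-≤ : ∀ n .{{_ : NonZero n}} {p q} → p ≤ℕ q → starBH n p ≤ starBH n q
starBH-mono-≤ n {p} {q} p≤q = begin
  starBH n p                                          ≡⟨ ℚP.+-identityʳ (starBH n p) ⟨
  starBH n p + 0ℚ                                     ≤⟨ ℚP.+-monoʳ-≤ (starBH n p) (starBH-increment-nonNeg n p (q ∸ p)) ⟩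
  starBH n p + starBH-increment n p (q ∸ p)           ≡⟨ starBH-+ n p (q ∸ p) ⟨
  starBH n (p +ℕ (q ∸ p))                             ≡⟨ cong (starBH n) (ℕP.m+[n∸m]≡n p≤q) ⟩
  starBH n q                                          ∎
  where open ℚP.≤-Reasoning

starBH-mono-< : ∀ n .{{_ : NonZero n}} {p q} → p ℕ.< q → starBH n p < starBH n q
starBH-mono-< n {p} {q} p<q = begin-strict
  starBH n p                                          ≡⟨ ℚP.+-identityʳ (starBH n p) ⟨
  starBH n p + 0ℚ                                     <⟨ ℚP.+-monoʳ-< (starBH n p) (starBH-increment-pos n p d) ⟩
  starBH n p + starBH-increment n p (suc d)           ≡⟨ starBH-+ n p (suc d) ⟨
  starBH n (p +ℕ suc d)                               ≡⟨ cong (starBH n) (trans (ℕP.+-suc p d) (ℕP.m+[n∸m]≡n p<q)) ⟩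
  starBH n q                                          ∎
  where
  open ℚP.≤-Reasoning
  d = q ∸ suc p

starBH-injective : ∀ n .{{_ : NonZero n}} {p q} → starBH n p ≡ starBH n q → p ≡ q
starBH-injective n {p} {q} eq with ℕP.<-cmp p q
... | tri< p<q _ _ = contradiction eq (ℚP.<⇒≢ (starBH-mono-< n p<q))
... | tri≈ _ p≡q _ = p≡q
... | tri> _ _ q<p = contradiction (sym eq) (ℚP.<⇒≢ (starBH-mono-< n q<p))

-- Products of two numbers with a given sum

m+n≡m⇒n≡0 : ∀ m n → m +ℕ n ≡ m → n ≡ 0
m+n≡m⇒n≡0 m n eq = ℕP.+-cancelˡ-≡ m n 0 (trans eq (sym (ℕP.+-identityʳ m)))

suc*suc≡+ : ∀ a b → suc a *ℕ suc b ≡ (a +ℕ suc b) +ℕ a *ℕ b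
suc*suc≡+ = ℕ-solve-∀

a+b-1≤a*b : ∀ a b → a +ℕ suc b ≤ℕ suc a *ℕ suc b
a+b-1≤a*b a b = subst (a +ℕ suc b ≤ℕ_) (sym (suc*suc≡+ a b)) (ℕP.m≤m+n (a +ℕ suc b) (a *ℕ b))

a+b-1≡a*b⇒ : ∀ a b → a +ℕ suc b ≡ suc a *ℕ suc b → a ≡ 0 ⊎ b ≡ 0
a+b-1≡a*b⇒ a b eq = ℕP.m*n≡0⇒m≡0∨n≡0 a (m+n≡m⇒n≡0 (a +ℕ suc b) (a *ℕ b) (trans (sym (suc*suc≡+ a b)) (sym eq)))

⌊b+d+b/2⌋ : ∀ b d → ⌊ (b +ℕ d) +ℕ b /2⌋ ≡ b +ℕ ⌊ d /2⌋
⌊b+d+b/2⌋ zero    d = cong ⌊_/2⌋ (ℕP.+-identityʳ d)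
⌊b+d+b/2⌋ (suc b) d = trans (cong (λ x → ⌊ suc x /2⌋) (ℕP.+-suc (b +ℕ d) b)) (cong suc (⌊b+d+b/2⌋ b d))

⌈b+d+b/2⌉ : ∀ b d → ⌈ (b +ℕ d) +ℕ b /2⌉ ≡ b +ℕ ⌈ d /2⌉
⌈b+d+b/2⌉ b d = trans (cong ⌊_/2⌋ (cong (_+ℕ b) (sym (ℕP.+-suc b d)))) (⌊b+d+b/2⌋ b (suc d))

balanced-identity : ∀ b d → (b +ℕ d) *ℕ b +ℕ ⌈ d /2⌉ *ℕ ⌊ d /2⌋ ≡ ⌈ (b +ℕ d) +ℕ b /2⌉ *ℕ ⌊ (b +ℕ d) +ℕ b /2⌋
balanced-identity b d = begin
  (b +ℕ d) *ℕ b +ℕ c *ℕ f              ≡⟨ cong (λ x → (b +ℕ x) *ℕ b +ℕ c *ℕ f) (sym (ℕP.⌊n/2⌋+⌈n/2⌉≡n d)) ⟩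
  (b +ℕ (f +ℕ c)) *ℕ b +ℕ c *ℕ f        ≡⟨ expand b c f ⟩
  (b +ℕ c) *ℕ (b +ℕ f)                ≡⟨ cong₂ _*ℕ_ (⌈b+d+b/2⌉ b d) (⌊b+d+b/2⌋ b d) ⟨
  ⌈ (b +ℕ d) +ℕ b /2⌉ *ℕ ⌊ (b +ℕ d) +ℕ b /2⌋ ∎
  where
  open ≡-Reasoning
  c = ⌈ d /2⌉
  f = ⌊ d /2⌋
  expand : ∀ b c f → (b +ℕ (f +ℕ c)) *ℕ b +ℕ c *ℕ f ≡ (b +ℕ c) *ℕ (b +ℕ f)
  expand = ℕ-solve-∀

balanced-product-ordered : ∀ b d → let s = (b +ℕ d) +ℕ b in
  ((b +ℕ d) *ℕ b ≤ℕ ⌈ s /2⌉ *ℕ ⌊ s /2⌋) × ((b +ℕ d) *ℕ b ≡ ⌈ s /2⌉ *ℕ ⌊ s /2⌋ → b +ℕ d ≡ ⌈ s /2⌉ × b ≡ ⌊ s /2⌋)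
balanced-product-ordered b d = subst ((b +ℕ d) *ℕ b ≤ℕ_) (balanced-identity b d) (ℕP.m≤m+n _ _) , equality
  where
  c = ⌈ d /2⌉
  f = ⌊ d /2⌋
  vanishing : c *ℕ f ≡ 0 → f ≡ 0
  vanishing cf≡0 with ℕP.m*n≡0⇒m≡0∨n≡0 c cf≡0
  ... | inj₁ c≡0 = ℕP.n≤0⇒n≡0 (subst (f ≤ℕ_) c≡0 (ℕP.⌊n/2⌋≤⌈n/2⌉ d))
  ... | inj₂ f≡0 = f≡0
  equality : (b +ℕ d) *ℕ b ≡ ⌈ (b +ℕ d) +ℕ b /2⌉ *ℕ ⌊ (b +ℕ d) +ℕ b /2⌋ →
             b +ℕ d ≡ ⌈ (b +ℕ d) +ℕ b /2⌉ × b ≡ ⌊ (b +ℕ d) +ℕ b /2⌋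
  equality eq = (begin
      b +ℕ d        ≡⟨ cong (b +ℕ_) (sym (ℕP.⌊n/2⌋+⌈n/2⌉≡n d)) ⟩
      b +ℕ (f +ℕ c)  ≡⟨ cong (λ x → b +ℕ (x +ℕ c)) ⌊d/2⌋≡0 ⟩
      b +ℕ c        ≡⟨ ⌈b+d+b/2⌉ b d ⟨
      ⌈ (b +ℕ d) +ℕ b /2⌉ ∎)
    , (begin
      b            ≡⟨ ℕP.+-identityʳ b ⟨
      b +ℕ 0        ≡⟨ cong (b +ℕ_) ⌊d/2⌋≡0 ⟨
      b +ℕ f        ≡⟨ ⌊b+d+b/2⌋ b d ⟨
      ⌊ (b +ℕ d) +ℕ b /2⌋ ∎)
    where
    open ≡-Reasoning
    ⌊d/2⌋≡0 : f ≡ 0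
    ⌊d/2⌋≡0 = vanishing (m+n≡m⇒n≡0 _ _ (trans (balanced-identity b d) (sym eq)))

balanced-product : ∀ a b → let c = ⌈ (a +ℕ b) /2⌉ ; f = ⌊ (a +ℕ b) /2⌋ in
  (a *ℕ b ≤ℕ c *ℕ f) × (a *ℕ b ≡ c *ℕ f → (a ≡ c × b ≡ f) ⊎ (a ≡ f × b ≡ c))
balanced-product a b with ℕP.≤-total b a
... | inj₁ b≤a with ℕP.m≤n⇒∃[o]m+o≡n b≤a
...   | d , refl = proj₁ (balanced-product-ordered b d) , λ eq → inj₁ (proj₂ (balanced-product-ordered b d) eq)
balanced-product a b | inj₂ a≤b with ℕP.m≤n⇒∃[o]m+o≡n a≤b
...   | d , refl rewrite ℕP.*-comm a (a +ℕ d) | ℕP.+-comm a (a +ℕ d) =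
        proj₁ (balanced-product-ordered a d) , λ eq → inj₂ (Product.swap (proj₂ (balanced-product-ordered a d) eq))

firstZagreb : ∀ {n} → Graph n → ℚ
firstZagreb G = Σ (λ i → degree G i * degree G i)

module _ {m n} {G : Graph m} {H : Graph n} (iso : G ≅ H) where
  private
    σ = proj₁ iso
    to = Inverse.to σ

  degree-≅ : ∀ i → degree H (to i) ≡ degree G i
  degree-≅ i = trans (Σ-permute σ (λ j → if H (to i) j then 1ℚ else 0ℚ))
                     (Σ-cong (λ j → cong (λ x → if x then 1ℚ else 0ℚ) (proj₂ iso i j)))

  firstZagreb-≅ : firstZagreb G ≡ firstZagreb H
  firstZagreb-≅ = sym (trans (Σ-permute σ (λ j → degree H j * degree H j))
                             (Σ-cong (λ i → cong₂ _*_ (degree-≅ i) (degree-≅ i))))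

-- Double stars

-- The quantities used below depend only on the parts of their arguments (away from the
-- diagonal), so sums over vertices become the weighted sums Σₚ with weights 1, 1, a, b.
data Part : Set where
  hubᵃ hubᵇ leafᵃ leafᵇ : Part

data Hub : Part → Set where
  hubᵃ : Hub hubᵃ
  hubᵇ : Hub hubᵇ

adjacent : Part → Part → Bool
adjacent hubᵃ  hubᵇ  = true
adjacent hubᵃ  leafᵃ = true
adjacent hubᵇ  hubᵃ  = true
adjacent hubᵇ  leafᵇ = true
adjacent leafᵃ hubᵃ  = true
adjacent leafᵇ hubᵇ  = true
adjacent _     _     = false

adjacent-sym : ∀ p q → adjacent p q ≡ adjacent q p
adjacent-sym hubᵃ  hubᵃ  = refl
adjacent-sym hubᵃ  hubᵇ  = refl
adjacent-sym hubᵃ  leafᵃ = refl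
adjacent-sym hubᵃ  leafᵇ = refl
adjacent-sym hubᵇ  hubᵃ  = refl
adjacent-sym hubᵇ  hubᵇ  = refl
adjacent-sym hubᵇ  leafᵃ = refl
adjacent-sym hubᵇ  leafᵇ = refl
adjacent-sym leafᵃ hubᵃ  = refl
adjacent-sym leafᵃ hubᵇ  = refl
adjacent-sym leafᵃ leafᵃ = refl
adjacent-sym leafᵃ leafᵇ = refl
adjacent-sym leafᵇ hubᵃ  = refl
adjacent-sym leafᵇ hubᵇ  = refl
adjacent-sym leafᵇ leafᵃ = refl
adjacent-sym leafᵇ leafᵇ = refl

-- Distance between distinct vertices of the given parts (0 on a centre, which is a single vertex).
dist : Part → Part → ℚ
dist hubᵃ  hubᵃ  = 0ℚ
dist hubᵃ  hubᵇ  = 1ℚ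
dist hubᵃ  leafᵃ = 1ℚ
dist hubᵃ  leafᵇ = 2ℚ
dist hubᵇ  hubᵃ  = 1ℚ
dist hubᵇ  hubᵇ  = 0ℚ
dist hubᵇ  leafᵃ = 2ℚ
dist hubᵇ  leafᵇ = 1ℚ
dist leafᵃ hubᵃ  = 1ℚ
dist leafᵃ hubᵇ  = 2ℚ
dist leafᵃ leafᵃ = 2ℚ
dist leafᵃ leafᵇ = 3ℚ
dist leafᵇ hubᵃ  = 2ℚ
dist leafᵇ hubᵇ  = 1ℚ
dist leafᵇ leafᵃ = 3ℚ
dist leafᵇ leafᵇ = 2ℚ

dist-sym : ∀ p q → dist p q ≡ dist q p
dist-sym hubᵃ  hubᵃ  = refl
dist-sym hubᵃ  hubᵇ  = refl
dist-sym hubᵃ  leafᵃ = refl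
dist-sym hubᵃ  leafᵇ = refl
dist-sym hubᵇ  hubᵃ  = refl
dist-sym hubᵇ  hubᵇ  = refl
dist-sym hubᵇ  leafᵃ = refl
dist-sym hubᵇ  leafᵇ = refl
dist-sym leafᵃ hubᵃ  = refl
dist-sym leafᵃ hubᵇ  = refl
dist-sym leafᵃ leafᵃ = refl
dist-sym leafᵃ leafᵇ = refl
dist-sym leafᵇ hubᵃ  = refl
dist-sym leafᵇ hubᵇ  = refl
dist-sym leafᵇ leafᵃ = refl
dist-sym leafᵇ leafᵇ = refl

module PartSums (A B : ℚ) where

  Σₚ : (Part → ℚ) → ℚ
  Σₚ g = g hubᵃ + (g hubᵇ + (A * g leafᵃ + B * g leafᵇ))

  adj : Part → Part → ℚ
  adj p q = if adjacent p q then 1ℚ else 0ℚ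

  deg : Part → ℚ
  deg p = Σₚ (adj p)

  N : ℚ
  N = 2ℚ + A + B

  rowDist rowDist² : Part → ℚ
  rowDist p = Σₚ (dist p) - dist p p
  rowDist² p = Σₚ (λ q → dist p q * dist p q) - dist p p * dist p p

  ΣE² Σr² Σr : ℚ
  ΣE² = Σₚ (λ p → (½ * ½) * rowDist² p)
  Σr² = Σₚ (λ p → (- ½ * rowDist p) * (- ½ * rowDist p))
  Σr  = Σₚ (λ p → - ½ * rowDist p)

  open +-*-Solver using (Polynomial; con; var; _:+_; _:*_; _:-_; ⟦_⟧↓; prove)

  -- Syntactic copies of the quantities above, as polynomials in A, B and t, so that identities
  -- between them are decided by normalisation.
  Aᴾ Bᴾ tᴾ : Polynomial 3
  Aᴾ = var zero
  Bᴾ = var (suc zero)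
  tᴾ = var (suc (suc zero))

  Σᴾ : (Part → Polynomial 3) → Polynomial 3
  Σᴾ g = g hubᵃ :+ (g hubᵇ :+ (Aᴾ :* g leafᵃ :+ Bᴾ :* g leafᵇ))

  degᴾ rowDistᴾ rowDist²ᴾ : Part → Polynomial 3
  degᴾ p = Σᴾ (λ q → con (adj p q))
  rowDistᴾ p = Σᴾ (λ q → con (dist p q)) :- con (dist p p)
  rowDist²ᴾ p = Σᴾ (λ q → con (dist p q) :* con (dist p q)) :- con (dist p p) :* con (dist p p)

  Nᴾ ΣE²ᴾ Σr²ᴾ Σrᴾ Qᴾ Kᴾ : Polynomial 3
  Nᴾ = con 2ℚ :+ Aᴾ :+ Bᴾ
  ΣE²ᴾ = Σᴾ (λ p → con (½ * ½) :* rowDist²ᴾ p)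
  Σr²ᴾ = Σᴾ (λ p → (con (- ½) :* rowDistᴾ p) :* (con (- ½) :* rowDistᴾ p))
  Σrᴾ  = Σᴾ (λ p → con (- ½) :* rowDistᴾ p)
  Qᴾ = (Aᴾ :* Bᴾ :+ con 1ℚ) :* (Aᴾ :* Bᴾ :+ con 1ℚ)
  Kᴾ = (Aᴾ :+ Bᴾ) :* (Nᴾ :* Nᴾ :- con 2ℚ :* Nᴾ :+ con 2ℚ :+ con 2ℚ :* (Aᴾ :* Bᴾ))

  ρ : Vec ℚ 3
  ρ = A ∷ B ∷ 0ℚ ∷ []

  tree-lhsᴾ : Part → Part → ℚ → Polynomial 3
  tree-lhsᴾ p q x = degᴾ p :* con (dist p q) :- degᴾ p :* (con x :* con (dist q q))
                    :- Σᴾ (λ r → con (adj p r) :* con (dist r q)) :+ con (adj p q) :* con (dist q q)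

  tree-rhsᴾ : Part → ℚ → Polynomial 3
  tree-rhsᴾ p x = (con 2ℚ :- degᴾ p) :- con 2ℚ :* con x

  tree-identity-by-normalisation : ∀ p q x → ⟦ tree-lhsᴾ p q x ⟧↓ ρ ≡ ⟦ tree-rhsᴾ p x ⟧↓ ρ →
    deg p * dist p q - deg p * (x * dist q q) - Σₚ (λ r → adj p r * dist r q) + adj p q * dist q q
      ≡ (2ℚ - deg p) - 2ℚ * x
  tree-identity-by-normalisation p q x = prove ρ (tree-lhsᴾ p q x) (tree-rhsᴾ p x)

  -- The entry (L D)ᵢⱼ part by part, x standing for δᵢⱼ; a centre is a single vertex, so two
  -- distinct vertices never lie in the same centre.
  tree-identity : ∀ p q x → (x ≡ 1ℚ × p ≡ q) ⊎ (x ≡ 0ℚ × (p ≡ q → Hub p → ⊥)) →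
    deg p * dist p q - deg p * (x * dist q q) - Σₚ (λ r → adj p r * dist r q) + adj p q * dist q q
      ≡ (2ℚ - deg p) - 2ℚ * x
  tree-identity hubᵃ  .hubᵃ  _ (inj₁ (refl , refl)) = tree-identity-by-normalisation hubᵃ  hubᵃ  1ℚ refl
  tree-identity hubᵇ  .hubᵇ  _ (inj₁ (refl , refl)) = tree-identity-by-normalisation hubᵇ  hubᵇ  1ℚ refl
  tree-identity leafᵃ .leafᵃ _ (inj₁ (refl , refl)) = tree-identity-by-normalisation leafᵃ leafᵃ 1ℚ refl
  tree-identity leafᵇ .leafᵇ _ (inj₁ (refl , refl)) = tree-identity-by-normalisation leafᵇ leafᵇ 1ℚ refl
  tree-identity hubᵃ  hubᵃ   _ (inj₂ (refl , ¬hub)) = contradiction hubᵃ (¬hub refl)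
  tree-identity hubᵃ  hubᵇ   _ (inj₂ (refl , _))    = tree-identity-by-normalisation hubᵃ  hubᵇ  0ℚ refl
  tree-identity hubᵃ  leafᵃ  _ (inj₂ (refl , _))    = tree-identity-by-normalisation hubᵃ  leafᵃ 0ℚ refl
  tree-identity hubᵃ  leafᵇ  _ (inj₂ (refl , _))    = tree-identity-by-normalisation hubᵃ  leafᵇ 0ℚ refl
  tree-identity hubᵇ  hubᵃ   _ (inj₂ (refl , _))    = tree-identity-by-normalisation hubᵇ  hubᵃ  0ℚ refl
  tree-identity hubᵇ  hubᵇ   _ (inj₂ (refl , ¬hub)) = contradiction hubᵇ (¬hub refl)
  tree-identity hubᵇ  leafᵃ  _ (inj₂ (refl , _))    = tree-identity-by-normalisation hubᵇ  leafᵃ 0ℚ refl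
  tree-identity hubᵇ  leafᵇ  _ (inj₂ (refl , _))    = tree-identity-by-normalisation hubᵇ  leafᵇ 0ℚ refl
  tree-identity leafᵃ hubᵃ   _ (inj₂ (refl , _))    = tree-identity-by-normalisation leafᵃ hubᵃ  0ℚ refl
  tree-identity leafᵃ hubᵇ   _ (inj₂ (refl , _))    = tree-identity-by-normalisation leafᵃ hubᵇ  0ℚ refl
  tree-identity leafᵃ leafᵃ  _ (inj₂ (refl , _))    = tree-identity-by-normalisation leafᵃ leafᵃ 0ℚ refl
  tree-identity leafᵃ leafᵇ  _ (inj₂ (refl , _))    = tree-identity-by-normalisation leafᵃ leafᵇ 0ℚ refl
  tree-identity leafᵇ hubᵃ   _ (inj₂ (refl , _))    = tree-identity-by-normalisation leafᵇ hubᵃ  0ℚ refl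
  tree-identity leafᵇ hubᵇ   _ (inj₂ (refl , _))    = tree-identity-by-normalisation leafᵇ hubᵇ  0ℚ refl
  tree-identity leafᵇ leafᵃ  _ (inj₂ (refl , _))    = tree-identity-by-normalisation leafᵇ leafᵃ 0ℚ refl
  tree-identity leafᵇ leafᵇ  _ (inj₂ (refl , _))    = tree-identity-by-normalisation leafᵇ leafᵇ 0ℚ refl

  BH-polynomial : ∀ t → N * t ≡ 1ℚ →
    N * (ΣE² - (t + t) * Σr² + (t * t) * (Σr * Σr))
      ≡ N * N + 4ℚ * (A * B) - 2ℚ * N + (A * B + 1ℚ) * (A * B + 1ℚ) * t
  BH-polynomial t N*t≡1 = begin
    N * (ΣE² - (t + t) * Σr² + (t * t) * (Σr * Σr))                  ≡⟨ cong (λ q → N * (ΣE² - (t + t) * Σr² + (t * t) * q)) Σr-squared ⟩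
    N * (ΣE² - (t + t) * Σr² + (t * t) * (Q + N * K))                ≡⟨ regroup N ΣE² Σr² t Q K ⟩
    N * ΣE² - 2ℚ * (N * t) * Σr² + (N * t) * (t * Q + (N * t) * K)  ≡⟨ cong (λ u → N * ΣE² - 2ℚ * u * Σr² + u * (t * Q + u * K)) N*t≡1 ⟩
    N * ΣE² - 2ℚ * 1ℚ * Σr² + 1ℚ * (t * Q + 1ℚ * K)                 ≡⟨ prove (A ∷ B ∷ t ∷ [])
        (Nᴾ :* ΣE²ᴾ :- con 2ℚ :* con 1ℚ :* Σr²ᴾ :+ con 1ℚ :* (tᴾ :* Qᴾ :+ con 1ℚ :* Kᴾ))
        (Nᴾ :* Nᴾ :+ con 4ℚ :* (Aᴾ :* Bᴾ) :- con 2ℚ :* Nᴾ :+ Qᴾ :* tᴾ) refl ⟩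
    N * N + 4ℚ * (A * B) - 2ℚ * N + Q * t                            ∎
    where
    open ≡-Reasoning
    Q = (A * B + 1ℚ) * (A * B + 1ℚ)
    K = (A + B) * (N * N - 2ℚ * N + 2ℚ + 2ℚ * (A * B))
    -- Σr = −((N − 1)² + AB), whose square is (AB + 1)² modulo N.
    Σr-squared : Σr * Σr ≡ Q + N * K
    Σr-squared = prove ρ (Σrᴾ :* Σrᴾ) (Qᴾ :+ Nᴾ :* Kᴾ) refl
    regroup : ∀ N X R t Q K → N * (X - (t + t) * R + (t * t) * (Q + N * K))
                              ≡ N * X - 2ℚ * (N * t) * R + (N * t) * (t * Q + (N * t) * K)
    regroup = solve-∀ ℚ-ring

  product-from-degrees : A * B ≡ ½ * ((A + B) * (A + B) + 3ℚ * (A + B) + 2ℚ - Σₚ (λ p → deg p * deg p))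
  product-from-degrees = prove ρ (Aᴾ :* Bᴾ)
    (con ½ :* ((Aᴾ :+ Bᴾ) :* (Aᴾ :+ Bᴾ) :+ con 3ℚ :* (Aᴾ :+ Bᴾ) :+ con 2ℚ :- Σᴾ (λ p → degᴾ p :* degᴾ p))) refl

module DoubleStar (a b : ℕ) where

  open PartSums (ℕ→ℚ a) (ℕ→ℚ b) public

  n : ℕ
  n = 2 +ℕ a +ℕ b

  G : Graph n
  G = doubleStar a b

  part : Fin n → Part
  part zero          = hubᵃ
  part (suc zero)    = hubᵇ
  part (suc (suc k)) = if toℕ k <ᵇ a then leafᵃ else leafᵇ

  Σ-part : ∀ g → Σ (λ i → g (part i)) ≡ Σₚ g
  Σ-part g = cong (λ s → g hubᵃ + (g hubᵇ + s)) (Σ-<ᵇ a b (λ x → g (if x then leafᵃ else leafᵇ)))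

  doubleStar-part : ∀ i j → G i j ≡ adjacent (part i) (part j)
  doubleStar-part zero          zero          = refl
  doubleStar-part zero          (suc zero)    = refl
  doubleStar-part zero          (suc (suc l)) with toℕ l <ᵇ a
  ... | true  = refl
  ... | false = refl
  doubleStar-part (suc zero)    zero          = refl
  doubleStar-part (suc zero)    (suc zero)    = refl
  doubleStar-part (suc zero)    (suc (suc l)) with toℕ l <ᵇ a
  ... | true  = refl
  ... | false = refl
  doubleStar-part (suc (suc k)) zero          with toℕ k <ᵇ a
  ... | true  = refl
  ... | false = refl
  doubleStar-part (suc (suc k)) (suc zero)    with toℕ k <ᵇ a
  ... | true  = refl
  ... | false = refl
  doubleStar-part (suc (suc k)) (suc (suc l)) with toℕ k <ᵇ a | toℕ l <ᵇ a
  ... | true  | true  = refl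
  ... | true  | false = refl
  ... | false | true  = refl
  ... | false | false = refl

  indicator-part : ∀ i j → (if G i j then 1ℚ else 0ℚ) ≡ adj (part i) (part j)
  indicator-part i j = cong (λ x → if x then 1ℚ else 0ℚ) (doubleStar-part i j)

  degree-part : ∀ i → degree G i ≡ deg (part i)
  degree-part i = trans (Σ-cong (indicator-part i)) (Σ-part (adj (part i)))

  L : Matrix n
  L = laplacian G

  laplacian-part : ∀ i k → L i k ≡ δ i k * deg (part i) - adj (part i) (part k)
  laplacian-part i k = cong₂ _-_
    (trans (if-then-0 (does (i ≟ k)) (degree G i)) (cong (δ i k *_) (degree-part i)))
    (indicator-part i k)

  laplacian-symmetric : transpose L ≈ₘ L
  laplacian-symmetric i j = begin
    L j i                                                ≡⟨ laplacian-part j i ⟩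
    δ j i * deg (part j) - adj (part j) (part i)         ≡⟨ cong₂ _-_ (δ-deg i j) (cong (λ x → if x then 1ℚ else 0ℚ) (adjacent-sym (part j) (part i))) ⟩
    δ i j * deg (part i) - adj (part i) (part j)         ≡⟨ laplacian-part i j ⟨
    L i j                                                ∎
    where
    open ≡-Reasoning
    δ-deg : ∀ i j → δ j i * deg (part j) ≡ δ i j * deg (part i)
    δ-deg i j = trans (cong (_* deg (part j)) (δ-sym j i)) (sym (δ-* i j (λ k → deg (part k))))

  part≡hubᵃ : ∀ j → part j ≡ hubᵃ → j ≡ zero
  part≡hubᵃ zero          _ = refl
  part≡hubᵃ (suc zero)    ()
  part≡hubᵃ (suc (suc l)) eq with toℕ l <ᵇ a
  part≡hubᵃ (suc (suc l)) () | true
  part≡hubᵃ (suc (suc l)) () | false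

  part≡hubᵇ : ∀ j → part j ≡ hubᵇ → j ≡ suc zero
  part≡hubᵇ zero          ()
  part≡hubᵇ (suc zero)    _ = refl
  part≡hubᵇ (suc (suc l)) eq with toℕ l <ᵇ a
  part≡hubᵇ (suc (suc l)) () | true
  part≡hubᵇ (suc (suc l)) () | false

  hub-part-injective : ∀ i j → part i ≡ part j → Hub (part i) → i ≡ j
  hub-part-injective zero          j eq _ = sym (part≡hubᵃ j (sym eq))
  hub-part-injective (suc zero)    j eq _ = sym (part≡hubᵇ j (sym eq))
  hub-part-injective (suc (suc k)) j eq hub with toℕ k <ᵇ a
  hub-part-injective (suc (suc k)) j eq () | true
  hub-part-injective (suc (suc k)) j eq () | false

  D : Matrix n
  D i j = if does (i ≟ j) then 0ℚ else dist (part i) (part j)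

  D-symmetric : transpose D ≈ₘ D
  D-symmetric i j with j ≟ i | i ≟ j
  ... | yes refl | yes _    = refl
  ... | yes refl | no i≢i   = contradiction refl i≢i
  ... | no j≢j   | yes refl = contradiction refl j≢j
  ... | no _     | no _     = dist-sym (part j) (part i)

  laplacian-⊗-D : ∀ i j → (L ⊗ D) i j ≡ (2ℚ - deg (part i)) - 2ℚ * δ i j
  laplacian-⊗-D i j = begin
    Σ (λ k → L i k * D k j)
      ≡⟨ Σ-cong (λ k → trans (cong₂ _*_ (laplacian-part i k) (offDiagonal-split (λ k j → dist (part k) (part j)) k j))
                              (expand (δ i k) g (α k) (e k) (δ k j) c)) ⟩
    Σ (λ k → δ i k * (g * e k) - δ i k * (g * (δ k j * c)) - α k * e k + (α k * c) * δ k j)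
      ≡⟨ Σ-linear₄ (λ k → δ i k * (g * e k)) (λ k → δ i k * (g * (δ k j * c))) (λ k → α k * e k) (λ k → (α k * c) * δ k j) ⟩
    Σ (λ k → δ i k * (g * e k)) - Σ (λ k → δ i k * (g * (δ k j * c))) - Σ (λ k → α k * e k) + Σ (λ k → (α k * c) * δ k j)
      ≡⟨ cong₂ (λ u v → u - v + Σ (λ k → (α k * c) * δ k j))
           (cong₂ _-_ (Σ-δ* i (λ k → g * e k)) (Σ-δ* i (λ k → g * (δ k j * c))))
           (Σ-part (λ r → adj (part i) r * dist r (part j))) ⟩
    g * e i - g * (δ i j * c) - Σₚ (λ r → adj (part i) r * dist r (part j)) + Σ (λ k → (α k * c) * δ k j)
      ≡⟨ cong (λ w → g * e i - g * (δ i j * c) - Σₚ (λ r → adj (part i) r * dist r (part j)) + w) (Σ-*δ j (λ k → α k * c)) ⟩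
    g * e i - g * (δ i j * c) - Σₚ (λ r → adj (part i) r * dist r (part j)) + α j * c
      ≡⟨ tree-identity (part i) (part j) (δ i j) dichotomy ⟩
    (2ℚ - g) - 2ℚ * δ i j  ∎
    where
    open ≡-Reasoning
    g = deg (part i)
    c = dist (part j) (part j)
    α e : Fin n → ℚ
    α k = adj (part i) (part k)
    e k = dist (part k) (part j)
    expand : ∀ d g a e d′ c → (d * g - a) * (e - d′ * c) ≡ d * (g * e) - d * (g * (d′ * c)) - a * e + (a * c) * d′
    expand = solve-∀ ℚ-ring
    dichotomy : (δ i j ≡ 1ℚ × part i ≡ part j) ⊎ (δ i j ≡ 0ℚ × (part i ≡ part j → Hub (part i) → ⊥))
    dichotomy with δ-dichotomy i j
    ... | inj₁ (δ≡1 , i≡j) = inj₁ (δ≡1 , cong part i≡j)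
    ... | inj₂ (δ≡0 , i≢j) = inj₂ (δ≡0 , λ eq hub → i≢j (hub-part-injective i j eq hub))

  E : Matrix n
  E i j = - ½ * D i j

  E-symmetric : transpose E ≈ₘ E
  E-symmetric i j = cong (- ½ *_) (D-symmetric i j)

  σ : Fin n → ℚ
  σ i = 1ℚ - ½ * deg (part i)

  laplacian-⊗-E : L ⊗ E ≈ₘ λ i j → δ i j - σ i
  laplacian-⊗-E i j = begin
    Σ (λ k → L i k * (- ½ * D k j))                  ≡⟨ Σ-cong (λ k → pull (L i k) (D k j)) ⟩
    Σ (λ k → - ½ * (L i k * D k j))                  ≡⟨ Σ-*ˡ (- ½) (λ k → L i k * D k j) ⟩
    - ½ * (L ⊗ D) i j                                ≡⟨ cong (- ½ *_) (laplacian-⊗-D i j) ⟩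
    - ½ * ((2ℚ - deg (part i)) - 2ℚ * δ i j)         ≡⟨ halve (deg (part i)) (δ i j) ⟩
    δ i j - σ i                                      ∎
    where
    open ≡-Reasoning
    pull : ∀ x y → x * (- ½ * y) ≡ - ½ * (x * y)
    pull = solve-∀ ℚ-ring
    halve : ∀ g d → - ½ * ((2ℚ - g) - 2ℚ * d) ≡ d - (1ℚ - ½ * g)
    halve = solve-∀ ℚ-ring

  Σ-offDiagonal : ∀ (h : Part → Part → ℚ) i →
    Σ (λ j → if does (i ≟ j) then 0ℚ else h (part i) (part j)) ≡ Σₚ (h (part i)) - h (part i) (part i)
  Σ-offDiagonal h i = begin
    Σ (λ j → if does (i ≟ j) then 0ℚ else h (part i) (part j))
      ≡⟨ Σ-cong (offDiagonal-split (λ i j → h (part i) (part j)) i) ⟩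
    Σ (λ j → h (part i) (part j) - δ i j * h (part j) (part j))
      ≡⟨ Σ-- (λ j → h (part i) (part j)) (λ j → δ i j * h (part j) (part j)) ⟩
    Σ (λ j → h (part i) (part j)) - Σ (λ j → δ i j * h (part j) (part j))
      ≡⟨ cong₂ _-_ (Σ-part (h (part i))) (Σ-δ* i (λ j → h (part j) (part j))) ⟩
    Σₚ (h (part i)) - h (part i) (part i)  ∎
    where open ≡-Reasoning

  E-rowSum : ∀ k → rowSum E k ≡ - ½ * rowDist (part k)
  E-rowSum k = trans (Σ-*ˡ (- ½) (D k)) (cong (- ½ *_) (Σ-offDiagonal dist k))

  E-sumSq : ∀ k → sumSq (E k) ≡ (½ * ½) * rowDist² (part k)
  E-sumSq k = begin
    Σ (λ j → (- ½ * D k j) * (- ½ * D k j))  ≡⟨ Σ-cong (λ j → square (D k j)) ⟩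
    Σ (λ j → (½ * ½) * (D k j * D k j))      ≡⟨ Σ-*ˡ (½ * ½) (λ j → D k j * D k j) ⟩
    (½ * ½) * Σ (λ j → D k j * D k j)        ≡⟨ cong ((½ * ½) *_) (trans (Σ-cong D²) (Σ-offDiagonal (λ p q → dist p q * dist p q) k)) ⟩
    (½ * ½) * rowDist² (part k)              ∎
    where
    open ≡-Reasoning
    square : ∀ x → (- ½ * x) * (- ½ * x) ≡ (½ * ½) * (x * x)
    square = solve-∀ ℚ-ring
    D² : ∀ j → D k j * D k j ≡ (if does (k ≟ j) then 0ℚ else dist (part k) (part j) * dist (part k) (part j))
    D² j with does (k ≟ j)
    ... | true  = ℚP.*-zeroˡ 0ℚ
    ... | false = refl

  t : ℚ
  t = (+ 1) / n

  open Centring {n} {t} (*-1/n n)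

  ℕ→ℚn≡N : ℕ→ℚ n ≡ N
  ℕ→ℚn≡N = trans (ℕ→ℚ-+ (2 +ℕ a) b) (cong (_+ ℕ→ℚ b) (ℕ→ℚ-+ 2 a))

  Penrose-doubleCentre-E : Penrose L (doubleCentre E)
  Penrose-doubleCentre-E =
    Penrose-doubleCentre σ laplacian-symmetric (laplacian-rowsSumToZero G) E-symmetric laplacian-⊗-E

  BH-doubleCentre-E : BH (doubleCentre E) ≡ starBH n (a *ℕ b)
  BH-doubleCentre-E = begin
    BH (doubleCentre E)                             ≡⟨ BH-rowsSumToZero {Y = doubleCentre E} (doubleCentre-rowsSumToZero E) ⟩
    ℕ→ℚ n * Σ (λ k → sumSq (doubleCentre E k))      ≡⟨ cong₂ _*_ ℕ→ℚn≡N (sumSq-doubleCentre E-symmetric) ⟩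
    N * (Σ (λ k → sumSq (E k)) - (t + t) * sumSq (rowSum E) + (t * t) * (Σ (rowSum E) * Σ (rowSum E)))
      ≡⟨ cong₂ (λ x r → N * (x - (t + t) * r + (t * t) * (Σ (rowSum E) * Σ (rowSum E)))) Σ-sumSq-E sumSq-rowSum-E ⟩
    N * (ΣE² - (t + t) * Σr² + (t * t) * (Σ (rowSum E) * Σ (rowSum E)))
      ≡⟨ cong (λ s → N * (ΣE² - (t + t) * Σr² + (t * t) * (s * s))) Σ-rowSum-E ⟩
    N * (ΣE² - (t + t) * Σr² + (t * t) * (Σr * Σr))  ≡⟨ BH-polynomial t (trans (cong (_* t) (sym ℕ→ℚn≡N)) (*-1/n n)) ⟩
    N * N + 4ℚ * (ℕ→ℚ a * ℕ→ℚ b) - 2ℚ * N + (ℕ→ℚ a * ℕ→ℚ b + 1ℚ) * (ℕ→ℚ a * ℕ→ℚ b + 1ℚ) * t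
      ≡⟨ cong₂ (λ m p → m * m + 4ℚ * p - 2ℚ * m + (p + 1ℚ) * (p + 1ℚ) * t) ℕ→ℚn≡N (ℕ→ℚ-* a b) ⟨
    ℕ→ℚ n * ℕ→ℚ n + 4ℚ * ℕ→ℚ (a *ℕ b) - 2ℚ * ℕ→ℚ n + (ℕ→ℚ (a *ℕ b) + 1ℚ) * (ℕ→ℚ (a *ℕ b) + 1ℚ) * t
      ≡⟨ starBH-cast n (a *ℕ b) ⟨
    starBH n (a *ℕ b)                               ∎
    where
    open ≡-Reasoning
    Σ-sumSq-E : Σ (λ k → sumSq (E k)) ≡ ΣE²
    Σ-sumSq-E = trans (Σ-cong E-sumSq) (Σ-part (λ p → (½ * ½) * rowDist² p))
    sumSq-rowSum-E : sumSq (rowSum E) ≡ Σr²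
    sumSq-rowSum-E = trans (Σ-cong (λ k → cong₂ _*_ (E-rowSum k) (E-rowSum k))) (Σ-part (λ p → (- ½ * rowDist p) * (- ½ * rowDist p)))
    Σ-rowSum-E : Σ (rowSum E) ≡ Σr
    Σ-rowSum-E = trans (Σ-cong E-rowSum) (Σ-part (λ p → - ½ * rowDist p))

  BH-pseudoInverse : (M : Matrix (2 +ℕ a +ℕ b)) → IsPseudoInverse (laplacian (doubleStar a b)) M →
    BH M ≡ starBH (2 +ℕ a +ℕ b) (a *ℕ b)
  BH-pseudoInverse M M⁺ =
    trans (BH-cong (Penrose-unique (IsPseudoInverse⇒Penrose M⁺) Penrose-doubleCentre-E)) BH-doubleCentre-E

  firstZagreb-doubleStar : firstZagreb G ≡ Σₚ (λ p → deg p * deg p)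
  firstZagreb-doubleStar = trans (Σ-cong (λ i → cong₂ _*_ (degree-part i) (degree-part i))) (Σ-part (λ p → deg p * deg p))

-- Isomorphisms between double stars

≅-doubleStar-product : ∀ {a b a′ b′} → a +ℕ b ≡ a′ +ℕ b′ → doubleStar a b ≅ doubleStar a′ b′ → a *ℕ b ≡ a′ *ℕ b′
≅-doubleStar-product {a} {b} {a′} {b′} sum≡ iso = ℕ→ℚ-injective (begin
  ℕ→ℚ (a *ℕ b)                   ≡⟨ ℕ→ℚ-* a b ⟩
  ℕ→ℚ a * ℕ→ℚ b                  ≡⟨ S.product-from-degrees ⟩
  ½ * (s * s + 3ℚ * s + 2ℚ - S.Σₚ (λ p → S.deg p * S.deg p))
    ≡⟨ cong₂ (λ x z → ½ * (x * x + 3ℚ * x + 2ℚ - z)) sumℚ≡ zagreb≡ ⟩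
  ½ * (s′ * s′ + 3ℚ * s′ + 2ℚ - S′.Σₚ (λ p → S′.deg p * S′.deg p))  ≡⟨ S′.product-from-degrees ⟨
  ℕ→ℚ a′ * ℕ→ℚ b′                ≡⟨ ℕ→ℚ-* a′ b′ ⟨
  ℕ→ℚ (a′ *ℕ b′)                 ∎)
  where
  open ≡-Reasoning
  module S = DoubleStar a b
  module S′ = DoubleStar a′ b′
  s = ℕ→ℚ a + ℕ→ℚ b
  s′ = ℕ→ℚ a′ + ℕ→ℚ b′
  sumℚ≡ : s ≡ s′
  sumℚ≡ = trans (sym (ℕ→ℚ-+ a b)) (trans (cong ℕ→ℚ sum≡) (ℕ→ℚ-+ a′ b′))
  zagreb≡ : S.Σₚ (λ p → S.deg p * S.deg p) ≡ S′.Σₚ (λ p → S′.deg p * S′.deg p)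
  zagreb≡ = trans (sym S.firstZagreb-doubleStar) (trans (firstZagreb-≅ {G = doubleStar a b} {H = doubleStar a′ b′} iso) S′.firstZagreb-doubleStar)

leafSwap : ∀ a b → Fin (a +ℕ b) → Fin (b +ℕ a)
leafSwap a b k = join b a (Sum.swap (splitAt a k))

leafSwap-involutive : ∀ a b k → leafSwap b a (leafSwap a b k) ≡ k
leafSwap-involutive a b k = begin
  join a b (Sum.swap (splitAt b (join b a (Sum.swap (splitAt a k)))))  ≡⟨ cong (λ s → join a b (Sum.swap s)) (splitAt-join b a (Sum.swap (splitAt a k))) ⟩
  join a b (Sum.swap (Sum.swap (splitAt a k)))                         ≡⟨ cong (join a b) (swap-involutive (splitAt a k)) ⟩
  join a b (splitAt a k)                                               ≡⟨ join-splitAt a b k ⟩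
  k                                                                    ∎
  where open ≡-Reasoning

leafSwap-side : ∀ a b (k : Fin (a +ℕ b)) → (toℕ (leafSwap a b k) <ᵇ b) ≡ not (toℕ k <ᵇ a)
leafSwap-side a b k = side (splitAt a k) refl
  where
  <ᵇ-true : ∀ {x y} → x ℕ.< y → (x <ᵇ y) ≡ true
  <ᵇ-true {zero}  {suc y} _         = refl
  <ᵇ-true {suc x} {suc y} (s≤s x<y) = <ᵇ-true x<y
  +<ᵇ-false : ∀ x y → (x +ℕ y <ᵇ x) ≡ false
  +<ᵇ-false zero    y = refl
  +<ᵇ-false (suc x) y = +<ᵇ-false x y
  side : ∀ s → splitAt a k ≡ s → (toℕ (join b a (Sum.swap s)) <ᵇ b) ≡ not (toℕ k <ᵇ a)
  side (inj₁ j) eq rewrite toℕ-↑ʳ b j | +<ᵇ-false b (toℕ j) | sym (splitAt⁻¹-↑ˡ eq)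
                         | toℕ-↑ˡ j b | <ᵇ-true (toℕ<n j) = refl
  side (inj₂ j) eq rewrite toℕ-↑ˡ j a | <ᵇ-true (toℕ<n j) | sym (splitAt⁻¹-↑ʳ eq)
                         | toℕ-↑ʳ a j | +<ᵇ-false a (toℕ j) = refl

doubleStar-swap : ∀ a b → doubleStar a b ≅ doubleStar b a
doubleStar-swap a b = mk↔ₛ′ (vertex a b) (vertex b a) (vertex-involutive b a) (vertex-involutive a b) , adjacency
  where
  vertex : ∀ a b → Fin (2 +ℕ a +ℕ b) → Fin (2 +ℕ b +ℕ a)
  vertex a b zero          = suc zero
  vertex a b (suc zero)    = zero
  vertex a b (suc (suc k)) = suc (suc (leafSwap a b k))
  vertex-involutive : ∀ a b i → vertex b a (vertex a b i) ≡ i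
  vertex-involutive a b zero          = refl
  vertex-involutive a b (suc zero)    = refl
  vertex-involutive a b (suc (suc k)) = cong (λ l → suc (suc l)) (leafSwap-involutive a b k)
  adjacency : ∀ i j → doubleStar b a (vertex a b i) (vertex a b j) ≡ doubleStar a b i j
  adjacency zero          zero          = refl
  adjacency zero          (suc zero)    = refl
  adjacency zero          (suc (suc l)) = trans (cong not (leafSwap-side a b l)) (not-involutive _)
  adjacency (suc zero)    zero          = refl
  adjacency (suc zero)    (suc zero)    = refl
  adjacency (suc zero)    (suc (suc l)) = leafSwap-side a b l
  adjacency (suc (suc k)) zero          = trans (cong not (leafSwap-side a b k)) (not-involutive _)
  adjacency (suc (suc k)) (suc zero)    = leafSwap-side a b k
  adjacency (suc (suc k)) (suc (suc l)) = refl

doubleStar-≅ : ∀ {a b a′ b′} → (a ≡ a′ × b ≡ b′) ⊎ (a ≡ b′ × b ≡ a′) → doubleStar a b ≅ doubleStar a′ b′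
doubleStar-≅ (inj₁ (refl , refl)) = ↔-id _ , λ i j → refl
doubleStar-≅ {a} {b} (inj₂ (refl , refl)) = doubleStar-swap a b

-- Since (k + 1)² = (k + 3)(k − 1) + 4, the lower bound is starBH at p = n − 3.
lowerBound≡starBH : ∀ n k .{{_ : NonZero n}} → n ≡ 3 +ℕ k → ℕ→ℚ (n *ℕ n +ℕ 3 *ℕ n) + (+ 4) / n - ℕ→ℚ 16 ≡ starBH n k
lowerBound≡starBH .(3 +ℕ k) k refl = begin
  ℕ→ℚ (n *ℕ n +ℕ 3 *ℕ n) + (+ 4) / n - ℕ→ℚ 16
    ≡⟨ cong₂ (λ x y → x + y - ℕ→ℚ 16) (trans (ℕ→ℚ-+ (n *ℕ n) (3 *ℕ n)) (cong₂ _+_ (ℕ→ℚ-* n n) (ℕ→ℚ-* 3 n))) (/-as-* 4 n) ⟩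
  (N * N + 3ℚ * N) + 4ℚ * t - ℕ→ℚ 16
    ≡⟨ cong (λ N → (N * N + 3ℚ * N) + 4ℚ * t - ℕ→ℚ 16) N≡3+K ⟩
  ((3ℚ + K) * (3ℚ + K) + 3ℚ * (3ℚ + K)) + 4ℚ * t - ℕ→ℚ 16
    ≡⟨ expand-16 K t ⟩
  (3ℚ + K) * (3ℚ + K) + 4ℚ * K - 2ℚ * (3ℚ + K) + (K - 1ℚ) * 1ℚ + 4ℚ * t
    ≡⟨ cong (λ u → (3ℚ + K) * (3ℚ + K) + 4ℚ * K - 2ℚ * (3ℚ + K) + (K - 1ℚ) * u + 4ℚ * t) [3+K]t≡1 ⟨
  (3ℚ + K) * (3ℚ + K) + 4ℚ * K - 2ℚ * (3ℚ + K) + (K - 1ℚ) * ((3ℚ + K) * t) + 4ℚ * t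
    ≡⟨ expand-square K t ⟨
  (3ℚ + K) * (3ℚ + K) + 4ℚ * K - 2ℚ * (3ℚ + K) + (K + 1ℚ) * (K + 1ℚ) * t
    ≡⟨ cong (λ N → N * N + 4ℚ * K - 2ℚ * N + (K + 1ℚ) * (K + 1ℚ) * t) N≡3+K ⟨
  N * N + 4ℚ * K - 2ℚ * N + (K + 1ℚ) * (K + 1ℚ) * t
    ≡⟨ starBH-cast n k ⟨
  starBH n k
    ∎
  where
  open ≡-Reasoning
  n = 3 +ℕ k
  N = ℕ→ℚ n
  K = ℕ→ℚ k
  t = (+ 1) / n
  N≡3+K : N ≡ 3ℚ + K
  N≡3+K = ℕ→ℚ-+ 3 k
  [3+K]t≡1 : (3ℚ + K) * t ≡ 1ℚ
  [3+K]t≡1 = trans (cong (_* t) (sym N≡3+K)) (*-1/n n)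
  expand-16 : ∀ K t → ((3ℚ + K) * (3ℚ + K) + 3ℚ * (3ℚ + K)) + 4ℚ * t - ℕ→ℚ 16
                    ≡ (3ℚ + K) * (3ℚ + K) + 4ℚ * K - 2ℚ * (3ℚ + K) + (K - 1ℚ) * 1ℚ + 4ℚ * t
  expand-16 = solve-∀ ℚ-ring
  expand-square : ∀ K t → (3ℚ + K) * (3ℚ + K) + 4ℚ * K - 2ℚ * (3ℚ + K) + (K + 1ℚ) * (K + 1ℚ) * t
                        ≡ (3ℚ + K) * (3ℚ + K) + 4ℚ * K - 2ℚ * (3ℚ + K) + (K - 1ℚ) * ((3ℚ + K) * t) + 4ℚ * t
  expand-square = solve-∀ ℚ-ring

lowest-product⇔≅ : ∀ a′ b′ →
  (a′ +ℕ suc b′ ≡ suc a′ *ℕ suc b′) ⇔ (doubleStar (suc a′) (suc b′) ≅ doubleStar 1 (a′ +ℕ suc b′))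
lowest-product⇔≅ a′ b′ = mk⇔
  (λ eq → doubleStar-≅ (parameters (a+b-1≡a*b⇒ a′ b′ eq)))
  (λ iso → sym (trans (≅-doubleStar-product refl iso) (ℕP.*-identityˡ (a′ +ℕ suc b′))))
  where
  parameters : a′ ≡ 0 ⊎ b′ ≡ 0 → (suc a′ ≡ 1 × suc b′ ≡ a′ +ℕ suc b′) ⊎ (suc a′ ≡ a′ +ℕ suc b′ × suc b′ ≡ 1)
  parameters (inj₁ a′≡0) = inj₁ (cong suc a′≡0 , cong (_+ℕ suc b′) (sym a′≡0))
  parameters (inj₂ b′≡0) = inj₂ (trans (sym (ℕP.+-comm a′ 1)) (cong (λ x → a′ +ℕ suc x) (sym b′≡0)) , cong suc b′≡0)

balanced-product⇔≅ : ∀ a b → let c = ⌈ (a +ℕ b) /2⌉ ; f = ⌊ (a +ℕ b) /2⌋ in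
  (a *ℕ b ≡ c *ℕ f) ⇔ (doubleStar a b ≅ doubleStar c f)
balanced-product⇔≅ a b = mk⇔
  (λ eq → doubleStar-≅ (proj₂ (balanced-product a b) eq))
  (≅-doubleStar-product (sym (trans (ℕP.+-comm ⌈ (a +ℕ b) /2⌉ ⌊ (a +ℕ b) /2⌋) (ℕP.⌊n/2⌋+⌈n/2⌉≡n (a +ℕ b)))))

theorem5p1 : (a b : ℕ) → 1 ≤ℕ a → 1 ≤ℕ b →
    (M : Matrix (2 +ℕ a +ℕ b)) → IsPseudoInverse (laplacian (doubleStar a b)) M →
    let n = 2 +ℕ a +ℕ b
        c = ⌈ (n ∸ 2) /2⌉
        f = ⌊ (n ∸ 2) /2⌋
        lo = ℕ→ℚ (n *ℕ n +ℕ 3 *ℕ n) + (+ 4) / n - ℕ→ℚ 16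
        up = ℕ→ℚ (n *ℕ n +ℕ 4 *ℕ c *ℕ f) - ℕ→ℚ (2 *ℕ n)
             + (+ ((c *ℕ f +ℕ 1) *ℕ (c *ℕ f +ℕ 1))) / n
    in (lo ≤ BH M) × (BH M ≤ up)
       × ((lo ≡ BH M) ⇔ (doubleStar a b ≅ doubleStar 1 (n ∸ 3)))
       × ((BH M ≡ up) ⇔ (doubleStar a b ≅ doubleStar c f))
theorem5p1 a@(suc a′) b@(suc b′) _ _ M M⁺ =
    subst₂ _≤_ (sym lo≡) (sym BH≡) (starBH-mono-≤ n {k} {a *ℕ b} (a+b-1≤a*b a′ b′))
  , subst₂ _≤_ (sym BH≡) (sym up≡) (starBH-mono-≤ n {a *ℕ b} {c *ℕ f} (proj₁ (balanced-product a b)))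
  , mk⇔ (λ eq → Equivalence.to (lowest-product⇔≅ a′ b′) (starBH-injective n (trans (sym lo≡) (trans eq BH≡))))
        (λ iso → trans lo≡ (trans (cong (starBH n) (Equivalence.from (lowest-product⇔≅ a′ b′) iso)) (sym BH≡)))
  , mk⇔ (λ eq → Equivalence.to (balanced-product⇔≅ a b) (starBH-injective n (trans (sym BH≡) (trans eq up≡))))
        (λ iso → trans BH≡ (trans (cong (starBH n) (Equivalence.from (balanced-product⇔≅ a b) iso)) (sym up≡)))
  where
  n = 2 +ℕ a +ℕ b
  k = n ∸ 3
  c = ⌈ (n ∸ 2) /2⌉
  f = ⌊ (n ∸ 2) /2⌋

  BH≡ : BH M ≡ starBH n (a *ℕ b)
  BH≡ = DoubleStar.BH-pseudoInverse a b M M⁺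

  lo≡ : ℕ→ℚ (n *ℕ n +ℕ 3 *ℕ n) + (+ 4) / n - ℕ→ℚ 16 ≡ starBH n k
  lo≡ = lowerBound≡starBH n k refl

  up≡ : ℕ→ℚ (n *ℕ n +ℕ 4 *ℕ c *ℕ f) - ℕ→ℚ (2 *ℕ n) + (+ ((c *ℕ f +ℕ 1) *ℕ (c *ℕ f +ℕ 1))) / n ≡ starBH n (c *ℕ f)
  up≡ = cong (λ x → ℕ→ℚ (n *ℕ n +ℕ x) - ℕ→ℚ (2 *ℕ n) + (+ ((c *ℕ f +ℕ 1) *ℕ (c *ℕ f +ℕ 1))) / n) (ℕP.*-assoc 4 c f)
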